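{- For even $n\ge 2$, every centrally symmetric matching in $\mathcal{M}_n$ lies in a connected component of $\mathcal{H}_n$ that contains exactly $n/2+1$ matchings.
   Context: Place $2n$ points equidistantly on the unit circle. $\mathcal{M}_n$ is the set of all non-crossing straight-line perfect matchings on these points. For $M\in\mathcal{M}_n$, two edges $e,f\in M$ span an empty quadrilateral if the convex hull of $e$ and $f$ contains no other edge of $M$; replacing $e,f$ by the other two edges of this quadrilateral yields another matching of $\mathcal{M}_n$ (a flip). A flip is centered if the closed quadrilateral contains the center of the circle (possibly on its boundary). $\mathcal{H}_n$ is the graph with vertex set $\mathcal{M}_n$ and an edge between two matchings if they differ by a centered flip. A matching is centrally symmetric if it is invariant under point reflection at the circle center. -}

module Defs where

open import Data.Nat using (ℕ; _+_; _*_; _≤_; _<_)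
open import Data.Fin using (Fin; toℕ)
open import Data.Vec using (Vec; lookup)
open import Data.Product using (Σ; _×_; _,_)
open import Data.Sum using (_⊎_)
open import Data.Empty using (⊥)
open import Relation.Nullary using (¬_)
open import Relation.Binary.PropositionalEquality using (_≡_; _≢_)
open import Relation.Binary.Construct.Closure.ReflexiveTransitive using (Star)
open import Relation.Binary.Construct.Closure.Symmetric using (SymClosure)

-- The 2n points on the unit circle are labelled 0,1,…,2n-1 in
-- counterclockwise order; point i sits at angle 2πi/(2n).
Pt : ℕ → Set
Pt n = Fin (2 * n)

-- A (candidate) matching on the 2n points: the partner function,
-- stored as a vector so that equality of matchings is propositional.
Vtx : ℕ → Set
Vtx n = Vec (Pt n) (2 * n)

-- x lies strictly between a and b (as labels), i.e. on one of the two
-- open arcs determined by the chord {a,b}.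
Btw : ℕ → ℕ → ℕ → Set
Btw x a b = (a < x × x < b) ⊎ (b < x × x < a)

-- Chords {a,b} and {c,d} (four distinct points on the circle) cross
-- iff c and d lie on different sides of the chord {a,b}.
Cross : ℕ → ℕ → ℕ → ℕ → Set
Cross a b c d = (Btw c a b × ¬ Btw d a b) ⊎ (¬ Btw c a b × Btw d a b)

CrossP : ∀ n → Pt n → Pt n → Pt n → Pt n → Set
CrossP n a b c d = Cross (toℕ a) (toℕ b) (toℕ c) (toℕ d)

IsPerfectMatching : ∀ n → Vtx n → Set
IsPerfectMatching n M =
  (∀ i → lookup M i ≢ i) × (∀ i → lookup M (lookup M i) ≡ i)

IsNonCrossing : ∀ n → Vtx n → Set
IsNonCrossing n M = ∀ i j → j ≢ i → j ≢ lookup M i →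
  ¬ CrossP n i (lookup M i) j (lookup M j)

IsNCMatching : ∀ n → Vtx n → Set
IsNCMatching n M = IsPerfectMatching n M × IsNonCrossing n M

Antipodal : ∀ n → Pt n → Pt n → Set
Antipodal n i j = (toℕ i + n ≡ toℕ j) ⊎ (toℕ j + n ≡ toℕ i)

CentrallySymmetric : ∀ n → Vtx n → Set
CentrallySymmetric n M = ∀ i j → Antipodal n i j →
  Antipodal n (lookup M i) (lookup M j)

-- point x lies in the n consecutive points s, s+1, …, s+n-1 (mod 2n);
-- a set of points lies in an open half circle iff it lies in such a block.
InBlock : ∀ n → Pt n → Pt n → Set
InBlock n s x =
  (toℕ s ≤ toℕ x × toℕ x < toℕ s + n) ⊎
  (toℕ x < toℕ s × toℕ x + 2 * n < toℕ s + n)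

-- The closed convex hull of the points a,b,c,d contains the center
-- iff the points are not contained in an open half circle.
Centered : ∀ n → Pt n → Pt n → Pt n → Pt n → Set
Centered n a b c d = ¬ Σ (Pt n) λ s →
  InBlock n s a × InBlock n s b × InBlock n s c × InBlock n s d

-- Edge {x,y} of M meets the closed quadrilateral spanned by the edges
-- {a,b},{c,d} whose other two sides are {a,c},{b,d}.  As all points lie
-- on the circle and x,y are not vertices of the quadrilateral, this
-- happens iff {x,y} crosses one of the four sides.
MeetsQuad : ∀ n → Pt n → Pt n → Pt n → Pt n → Pt n → Pt n → Set
MeetsQuad n x y a b c d =
  CrossP n x y a b ⊎ CrossP n x y c d ⊎ CrossP n x y a c ⊎ CrossP n x y b d

NotIn4 : ∀ n → Pt n → Pt n → Pt n → Pt n → Pt n → Set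
NotIn4 n x a b c d = x ≢ a × x ≢ b × x ≢ c × x ≢ d

-- M' arises from M by a centered flip: edges e = {a,b}, f = {c,d} of M
-- (b = M a, d = M c, e ≠ f) whose quadrilateral has sides e, {b,d}, f, {c,a}
-- (i.e. {a,c},{b,d} are non-crossing), which is empty (no other edge of M
-- meets its convex hull) and contains the center; M' replaces e,f by
-- {a,c},{b,d} and agrees with M elsewhere.
CenteredFlip : ∀ n → Vtx n → Vtx n → Set
CenteredFlip n M M' = Σ (Pt n) λ a → Σ (Pt n) λ c →
  let b = lookup M a ; d = lookup M c in
  c ≢ a × c ≢ b ×
  ¬ CrossP n a c b d ×
  (∀ x → NotIn4 n x a b c d → ¬ MeetsQuad n x (lookup M x) a b c d) ×
  Centered n a b c d ×
  lookup M' a ≡ c × lookup M' c ≡ a × lookup M' b ≡ d × lookup M' d ≡ b ×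
  (∀ x → NotIn4 n x a b c d → lookup M' x ≡ lookup M x)

HEdge : ∀ n → Vtx n → Vtx n → Set
HEdge n M M' = IsNCMatching n M × IsNCMatching n M' × CenteredFlip n M M'

SameComponent : ∀ n → Vtx n → Vtx n → Set
SameComponent n = Star (SymClosure (HEdge n))

-- A centrally symmetric matching M on 2n points, n even, has no diameter: a diameter would
-- leave the odd number n - 1 of points on either side to be matched among themselves.  Hence
-- identifying antipodal points turns M into a non-crossing perfect matching q of the n offsets.
-- In a symmetric matching without diameters every centered empty flip exchanges a chord with
-- its antipodal image, so the whole component consists of symmetric matchings with quotient q.
-- Such a matching is determined by which chords of q wrap, i.e. join the lower half of the
-- circle to the upper one, and the wrapping chords are always those covering one gap t - 1 | t
-- of the offsets (0 ≤ t ≤ n); call this matching lift t.  Moving the gap past an endpoint is a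
-- centered flip, and lift (t + 1) = lift (q t), so the component consists of lift 0 and of
-- lift (t + 1) for the n / 2 left endpoints t < q t of q.
--
-- Statements about at most five points and their antipodes are decided by enumeration: coding
-- a point by its half and its offset turns the cyclic order into the lexicographic one and the
-- antipodal map into flipping the half, so such a statement only depends on the halves and on
-- the order type of the offsets, which may be replaced by their ranks.

module Submission where

open import Data.Bool using (Bool; true; false; not; _∧_; _∨_; _xor_; if_then_else_; T)
import Data.Bool
open import Data.Bool.ListAction using (and)
open import Data.Bool.Properties
  using (T?; T-≡; T-not-≡; not-involutive; ¬-not; xor-comm; xor-assoc; xor-same; xor-identityʳ;
         not-distribˡ-xor; not-distribʳ-xor; xor-inverseʳ; xor-annihilates-not)
open import Data.Empty using (⊥; ⊥-elim)
open import Data.Fin using (Fin; zero; suc; toℕ; fromℕ<)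
open import Data.Fin.Patterns using (0F; 1F; 2F; 3F; 4F)
open import Data.Fin.Permutation using (permutation)
import Data.Fin.Properties as Fin
open import Data.Fin.Properties using (toℕ-injective; toℕ<n; toℕ-fromℕ<)
open import Data.List as List using (List; []; _∷_; _++_; length; filterᵇ; allFin)
open import Data.List.Membership.Propositional using (_∈_)
open import Data.List.Membership.Propositional.Properties
  using (∈-filter⁺; ∈-filter⁻; ∈-allFin; ∈-map⁺; ∈-map⁻)
open import Data.List.Properties using (length-map)
open import Data.List.Relation.Unary.All as All using (All; []; _∷_)
open import Data.List.Relation.Unary.All.Properties using (++⁺; map⁺)
open import Data.List.Relation.Unary.AllPairs using ([]; _∷_)
open import Data.List.Relation.Unary.Any using (here; there)
open import Data.List.Relation.Unary.Unique.Propositional using (Unique)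
open import Data.List.Relation.Unary.Unique.Propositional.Properties using (allFin⁺)
open import Data.Nat using (ℕ; zero; suc; _<ᵇ_; _<_; _≤_; _<?_; _+_; _*_; _∸_; _⊓_; z≤n; s≤s; s≤s⁻¹)
open import Data.Nat.Induction using (<-rec)
open import Data.Nat.Properties
  using (+-0-commutativeMonoid; *-cancelˡ-≡; +-assoc; +-cancelʳ-<; +-cancelʳ-≡; +-cancelˡ-<; +-cancelˡ-≡; +-comm;
         +-identityʳ; +-monoʳ-<; +-monoˡ-<; +-monoˡ-≤; +-suc; <-asym; <-cmp; <-irrefl; <-trans; <-≤-trans;
         <ᵇ⇒<; <⇒<ᵇ; <⇒≤; even≢odd; m+[n∸m]≡n; m<1+n⇒m<n∨m≡n; m<n⇒m<1+n; m∸n+n≡m; m≤m+n; m≤n+m;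
         m≤n⇒m≤1+n; m≤n⇒m⊓n≡m; m⊓n≤n; n<1+n; ≤-antisym; ≤-trans; ≤⇒≯; ≤∧≢⇒<; ≮⇒≥)
open import Algebra.Properties.CommutativeMonoid.Sum +-0-commutativeMonoid
  using (sum; sum-cong-≗; sum-permute; ∑-distrib-+)
open import Data.Product using (Σ; _×_; _,_; proj₁; proj₂)
open import Data.Sum using (_⊎_; inj₁; inj₂)
open import Data.Unit using (tt)
open import Data.Vec as Vec using (Vec; []; _∷_; lookup; tabulate)
open import Data.Vec.Membership.Propositional using () renaming (_∈_ to _∈ᵛ_)
open import Data.Vec.Membership.Propositional.Properties using (∈-lookup)
open import Data.Vec.Properties using (lookup-map; lookup∘tabulate; tabulate∘lookup; tabulate-cong)
open import Data.Vec.Relation.Unary.All as VecAll using ()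
open import Data.Vec.Relation.Unary.All.Properties using (lookup⁻)
open import Data.Vec.Relation.Unary.Any using (here; there)
open import Defs
open import Function using (_∘_; id; flip; _⇔_; mk⇔)
open import Function.Bundles using (Equivalence)
open import Relation.Binary.Construct.Closure.ReflexiveTransitive using (ε; _◅_; _◅◅_; reverse)
open import Relation.Binary.Construct.Closure.Symmetric using (fwd; bwd; symmetric)
open import Relation.Binary.Definitions using (tri<; tri≈; tri>)
open import Relation.Binary.PropositionalEquality
  using (_≡_; _≢_; refl; sym; trans; cong; cong₂; subst; subst₂; module ≡-Reasoning)
open import Relation.Nullary using (¬_; yes; no; Dec)
open import Relation.Nullary.Decidable using (_×-dec_; _⊎-dec_)

T-ext : ∀ {a b} → (T a → T b) → (T b → T a) → a ≡ b
T-ext {true}  {true}  _ _ = refl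
T-ext {true}  {false} f _ = ⊥-elim (f tt)
T-ext {false} {true}  _ g = ⊥-elim (g tt)
T-ext {false} {false} _ _ = refl

T-not : ∀ {a} → ¬ T a → T (not a)
T-not {true}  ¬a = ¬a tt
T-not {false} _  = tt

T-not⁻ : ∀ {a} → T (not a) → ¬ T a
T-not⁻ {true} ()

T-∧⁺ : ∀ {a b} → T a → T b → T (a ∧ b)
T-∧⁺ {true} _ b = b

T-∧⁻ : ∀ a {b} → T (a ∧ b) → T a × T b
T-∧⁻ true b = tt , b

T-∨⁺ˡ : ∀ {a} b → T a → T (a ∨ b)
T-∨⁺ˡ {true} _ _ = tt

T-∨⁺ʳ : ∀ a {b} → T b → T (a ∨ b)
T-∨⁺ʳ true  _ = tt
T-∨⁺ʳ false b = b

T-∨⁻ : ∀ a {b} → T (a ∨ b) → T a ⊎ T b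
T-∨⁻ true  _ = inj₁ tt
T-∨⁻ false b = inj₂ b

T-xor⁺ : ∀ {a b} → (T a × ¬ T b) ⊎ (¬ T a × T b) → T (a xor b)
T-xor⁺ {true}  {true}  (inj₁ (_ , ¬b)) = ¬b tt
T-xor⁺ {true}  {true}  (inj₂ (¬a , _)) = ¬a tt
T-xor⁺ {true}  {false} _               = tt
T-xor⁺ {false} {true}  _               = tt
T-xor⁺ {false} {false} (inj₁ (() , _))
T-xor⁺ {false} {false} (inj₂ (_ , ()))

T-xor⁻ : ∀ a {b} → T (a xor b) → (T a × ¬ T b) ⊎ (¬ T a × T b)
T-xor⁻ true  {false} _ = inj₁ (tt , λ ())
T-xor⁻ false {true}  _ = inj₂ ((λ ()) , tt)

infixr 2 _⇒_
_⇒_ : Bool → Bool → Bool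
a ⇒ b = not a ∨ b

T-⇒ : ∀ {a b} → (T a → T b) → T (a ⇒ b)
T-⇒ {true}  f = f tt
T-⇒ {false} _ = tt

T-⇒⁻ : ∀ {a b} → T (a ⇒ b) → T a → T b
T-⇒⁻ {true} b _ = b

infix 4 _==_
_==_ : Bool → Bool → Bool
a == b = not (a xor b)

==⇒≡ : ∀ {a b} → T (a == b) → a ≡ b
==⇒≡ {true}  {true}  _ = refl
==⇒≡ {false} {false} _ = refl

≡⇒== : ∀ {a b} → a ≡ b → T (a == b)
≡⇒== {true}  refl = tt
≡⇒== {false} refl = tt

infix 1 _⟹_
record Implication : Set where
  constructor _⟹_
  field
    premises   : List Bool
    conclusion : Bool

open Implication

valid : Implication → Bool
valid (ps ⟹ c) = and ps ⇒ c

modus-ponens : ∀ φ → T (valid φ) → All T (premises φ) → T (conclusion φ)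
modus-ponens (ps ⟹ c) v hs = T-⇒⁻ {and ps} v (T-and hs)
  where
  T-and : ∀ {bs} → All T bs → T (and bs)
  T-and []                = tt
  T-and {true ∷ _} (_ ∷ hs) = T-and hs

<⇒<ᵇ≡true : ∀ {a b} → a < b → (a <ᵇ b) ≡ true
<⇒<ᵇ≡true a<b = Equivalence.to T-≡ (<⇒<ᵇ a<b)

≮⇒<ᵇ≡false : ∀ {a b} → ¬ a < b → (a <ᵇ b) ≡ false
≮⇒<ᵇ≡false {a} {b} a≮b = Equivalence.to T-not-≡ (T-not (a≮b ∘ <ᵇ⇒< a b))

<ᵇ-suc : ∀ {x t} → x ≢ t → (x <ᵇ suc t) ≡ (x <ᵇ t)
<ᵇ-suc {x} {t} x≢t = T-ext (λ h → <⇒<ᵇ (≤∧≢⇒< (s≤s⁻¹ (<ᵇ⇒< x (suc t) h)) x≢t))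
                            (λ h → <⇒<ᵇ (m<n⇒m<1+n (<ᵇ⇒< x t h)))

<ᵇ-suc-flip : ∀ x c → (x <ᵇ suc c) ≡ not (c <ᵇ x)
<ᵇ-suc-flip x c = T-ext
  (λ h → T-not λ c<x → <-irrefl refl (<-≤-trans (<ᵇ⇒< c x c<x) (s≤s⁻¹ (<ᵇ⇒< x (suc c) h))))
  (λ h → <⇒<ᵇ (s≤s (≮⇒≥ (T-not⁻ h ∘ <⇒<ᵇ {c} {x}))))

-- Order types

rank : ∀ {m} → Vec ℕ m → ℕ → ℕ
rank []       x = 0
rank (z ∷ zs) x with z <? x
... | yes _ = suc (rank zs x)
... | no  _ = rank zs x

rank-≤ : ∀ {m} (xs : Vec ℕ m) x → rank xs x ≤ m
rank-≤ []       x = z≤n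
rank-≤ (z ∷ zs) x with z <? x
... | yes _ = s≤s (rank-≤ zs x)
... | no  _ = m≤n⇒m≤1+n (rank-≤ zs x)

rank-mono : ∀ {m} (xs : Vec ℕ m) {x y} → x ≤ y → rank xs x ≤ rank xs y
rank-mono []       _   = z≤n
rank-mono (z ∷ zs) {x} {y} x≤y with z <? x | z <? y
... | yes _   | yes _   = s≤s (rank-mono zs x≤y)
... | yes z<x | no  z≮y = ⊥-elim (z≮y (<-≤-trans z<x x≤y))
... | no  _   | yes _   = m≤n⇒m≤1+n (rank-mono zs x≤y)
... | no  _   | no  _   = rank-mono zs x≤y

rank-strict : ∀ {m} {xs : Vec ℕ m} {x y} → x ∈ᵛ xs → x < y → rank xs x < rank xs y
rank-strict {xs = z ∷ zs} {x} {y} (here refl) x<y with z <? z | z <? y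
... | yes z<z | _       = ⊥-elim (<-irrefl refl z<z)
... | no  _   | yes _   = s≤s (rank-mono zs (<⇒≤ x<y))
... | no  _   | no  z≮y = ⊥-elim (z≮y x<y)
rank-strict {xs = z ∷ zs} {x} {y} (there x∈zs) x<y with z <? x | z <? y
... | yes _   | yes _   = s≤s (rank-strict x∈zs x<y)
... | yes z<x | no  z≮y = ⊥-elim (z≮y (<-trans z<x x<y))
... | no  _   | yes _   = m<n⇒m<1+n (rank-strict x∈zs x<y)
... | no  _   | no  _   = rank-strict x∈zs x<y

rank-bound : ∀ {m} {xs : Vec ℕ m} {x} → x ∈ᵛ xs → rank xs x < m
rank-bound {xs = z ∷ zs} (here refl) with z <? z
... | yes z<z = ⊥-elim (<-irrefl refl z<z)
... | no  _   = s≤s (rank-≤ zs z)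
rank-bound {xs = z ∷ zs} {x} (there x∈zs) with z <? x
... | yes _ = s≤s (rank-bound x∈zs)
... | no  _ = m<n⇒m<1+n (rank-bound x∈zs)

rank-<ᵇ : ∀ {m} {xs : Vec ℕ m} {x} y → x ∈ᵛ xs → (rank xs x <ᵇ rank xs y) ≡ (x <ᵇ y)
rank-<ᵇ {xs = xs} {x} y x∈xs = T-ext to (<⇒<ᵇ ∘ rank-strict x∈xs ∘ <ᵇ⇒< x y)
  where
  to : T (rank xs x <ᵇ rank xs y) → T (x <ᵇ y)
  to r<r with <-cmp x y
  ... | tri< x<y _ _ = <⇒<ᵇ x<y
  ... | tri≈ _ refl _ = ⊥-elim (<-irrefl refl (<ᵇ⇒< (rank xs x) _ r<r))
  ... | tri> _ _ y<x = ⊥-elim (<-irrefl refl (<-≤-trans (<ᵇ⇒< _ _ r<r) (rank-mono xs (<⇒≤ y<x))))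

Comparisons : ℕ → Set
Comparisons m = Vec (Vec Bool m) m

comparisons : ∀ {m} → Vec ℕ m → Comparisons m
comparisons xs = tabulate λ i → tabulate λ j → lookup xs i <ᵇ lookup xs j

ranks : ∀ {m} → Vec ℕ m → Vec ℕ m
ranks xs = Vec.map (rank xs) xs

comparisons-ranks : ∀ {m} (xs : Vec ℕ m) → comparisons (ranks xs) ≡ comparisons xs
comparisons-ranks xs = tabulate-cong λ i → tabulate-cong λ j → begin
  lookup (ranks xs) i <ᵇ lookup (ranks xs) j
    ≡⟨ cong₂ _<ᵇ_ (lookup-map i (rank xs) xs) (lookup-map j (rank xs) xs) ⟩
  rank xs (lookup xs i) <ᵇ rank xs (lookup xs j)  ≡⟨ rank-<ᵇ (lookup xs j) (∈-lookup i xs) ⟩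
  lookup xs i <ᵇ lookup xs j                      ∎
  where open ≡-Reasoning

ranks-bounded : ∀ {m} (xs : Vec ℕ m) → VecAll.All (_< m) (ranks xs)
ranks-bounded xs = lookup⁻ λ i → subst (_< _) (sym (lookup-map i (rank xs) xs)) (rank-bound (∈-lookup i xs))

allBelow : ℕ → (ℕ → Bool) → Bool
allBelow zero    f = true
allBelow (suc n) f = allBelow n f ∧ f n

allBelow-sound : ∀ n f {x} → T (allBelow n f) → x < n → T (f x)
allBelow-sound (suc n) f h x<1+n with m<1+n⇒m<n∨m≡n x<1+n
... | inj₁ x<n  = allBelow-sound n f (proj₁ (T-∧⁻ (allBelow n f) h)) x<n
... | inj₂ refl = proj₂ (T-∧⁻ (allBelow n f) h)

allVecsBelow : ∀ m → ℕ → (Vec ℕ m → Bool) → Bool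
allVecsBelow zero    n f = f []
allVecsBelow (suc m) n f = allBelow n λ x → allVecsBelow m n (f ∘ (x ∷_))

allVecsBelow-sound : ∀ {m n} f {xs : Vec ℕ m} → T (allVecsBelow m n f) → VecAll.All (_< n) xs → T (f xs)
allVecsBelow-sound f {[]}     h VecAll.[]           = h
allVecsBelow-sound {suc m} {n} f {x ∷ xs} h (x<n VecAll.∷ xs<n) =
  allVecsBelow-sound (f ∘ (x ∷_)) (allBelow-sound n (λ y → allVecsBelow m n (f ∘ (y ∷_))) h x<n) xs<n

allSigns : ∀ j → (Vec Bool j → Bool) → Bool
allSigns zero    f = f []
allSigns (suc j) f = allSigns j (f ∘ (true ∷_)) ∧ allSigns j (f ∘ (false ∷_))

allSigns-sound : ∀ {j} f (σ : Vec Bool j) → T (allSigns j f) → T (f σ)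
allSigns-sound f []          h = h
allSigns-sound {suc j} f (true ∷ σ) h =
  allSigns-sound (f ∘ (true ∷_)) σ (proj₁ (T-∧⁻ (allSigns j (f ∘ (true ∷_))) h))
allSigns-sound {suc j} f (false ∷ σ) h =
  allSigns-sound (f ∘ (false ∷_)) σ (proj₂ (T-∧⁻ (allSigns j (f ∘ (true ∷_))) h))

OrderTypeFact : ℕ → ℕ → Set
OrderTypeFact j m = Vec Bool j → Comparisons m → Implication

CheckedOnRanks : ∀ {j m} → OrderTypeFact j m → Set
CheckedOnRanks {j} {m} F = T (allSigns j λ σ → allVecsBelow m m λ ρ → valid (F σ (comparisons ρ)))

order-type-fact : ∀ {j m} (F : OrderTypeFact j m) → CheckedOnRanks F → ∀ σ xs →
                  All T (premises (F σ (comparisons xs))) → T (conclusion (F σ (comparisons xs)))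
order-type-fact F checked σ xs = modus-ponens (F σ (comparisons xs))
  (subst (λ t → T (valid (F σ t))) (comparisons-ranks xs)
    (allVecsBelow-sound (valid ∘ F σ ∘ comparisons) (allSigns-sound _ σ checked) (ranks-bounded xs)))

-- Cyclic order of coded points

lex : Bool → Bool → Bool → Bool
lex s s' l = (not s ∧ s') ∨ ((s == s') ∧ l)

module CyclicOrder {X : Set} (_≺_ : X → X → Bool) (upper : X → Bool) (antipode : X → X) where

  _≈_ : X → X → Bool
  x ≈ y = not (x ≺ y) ∧ not (y ≺ x)

  between : X → X → X → Bool
  between x a b = (a ≺ x ∧ x ≺ b) ∨ (b ≺ x ∧ x ≺ a)

  crosses : X → X → X → X → Bool
  crosses a b c d = between c a b xor between d a b

  inBlock : X → X → Bool
  inBlock s x = if upper s then not (x ≺ s) ∨ x ≺ antipode s else not (x ≺ s) ∧ x ≺ antipode s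

  sameBlock : X → X → X → X → X → Bool
  sameBlock s a b c d = inBlock s a ∧ inBlock s b ∧ inBlock s c ∧ inBlock s d

  avoids : X → X → X → X → X → Bool
  avoids x a b c d = not (x ≈ a) ∧ not (x ≈ b) ∧ not (x ≈ c) ∧ not (x ≈ d)

  meetsQuad : X → X → X → X → X → X → Bool
  meetsQuad x y a b c d = crosses x y a b ∨ crosses x y c d ∨ crosses x y a c ∨ crosses x y b d

Pos : Set
Pos = Bool × ℕ

_≺ᴾ_ : Pos → Pos → Bool
(s , r) ≺ᴾ (s' , r') = lex s s' (r <ᵇ r')

antipodeᴾ : Pos → Pos
antipodeᴾ (s , r) = not s , r

module PosOrder = CyclicOrder _≺ᴾ_ proj₁ antipodeᴾ

lower≈⇒≡ : ∀ {x y} → T (PosOrder._≈_ (false , x) (false , y)) → x ≡ y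
lower≈⇒≡ {x} {y} h with T-∧⁻ (not (x <ᵇ y)) h
... | x≮y , y≮x = ≤-antisym (≮⇒≥ (T-not⁻ y≮x ∘ <⇒<ᵇ)) (≮⇒≥ (T-not⁻ x≮y ∘ <⇒<ᵇ))

≡⇒lower≈ : ∀ {x y} → x ≡ y → T (PosOrder._≈_ (false , x) (false , y))
≡⇒lower≈ {x} refl = T-∧⁺ (T-not (<-irrefl refl ∘ <ᵇ⇒< x x)) (T-not (<-irrefl refl ∘ <ᵇ⇒< x x))

SignedIndex : ℕ → Set
SignedIndex m = Bool × Fin m

antipodeᵀ : ∀ {m} → SignedIndex m → SignedIndex m
antipodeᵀ (s , i) = not s , i

module TableOrder {m} (t : Comparisons m) =
  CyclicOrder (λ (s , i) (s' , j) → lex s s' (lookup (lookup t i) j)) proj₁ antipodeᵀ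

apartᴺ : ℕ → ℕ → ℕ → Bool
apartᴺ x y z = not (PosOrder._≈_ (false , x) (false , y)) ∧ not (PosOrder._≈_ (false , x) (false , z))

apartᴺ⇒≢ : ∀ x {y z} → T (apartᴺ x y z) → x ≢ y × x ≢ z
apartᴺ⇒≢ x {y} {z} h with T-∧⁻ (not (PosOrder._≈_ (false , x) (false , y))) h
... | x≉y , x≉z = T-not⁻ x≉y ∘ ≡⇒lower≈ , T-not⁻ x≉z ∘ ≡⇒lower≈

module Labels (n : ℕ) where

  open PosOrder public

  label : Pos → ℕ
  label (false , r) = r
  label (true  , r) = r + n

  data Proper : Pos → Set where
    proper : ∀ {s r} → r < n → Proper (s , r)

  Proper-antipode : ∀ {q} → Proper q → Proper (antipodeᴾ q)
  Proper-antipode (proper r<n) = proper r<n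

  label<2n : ∀ {q} → Proper q → label q < n + n
  label<2n {false , r} (proper r<n) = <-≤-trans r<n (m≤m+n n n)
  label<2n {true  , r} (proper r<n) = +-monoˡ-< n r<n

  label-injective : ∀ {q q'} → Proper q → Proper q' → label q ≡ label q' → q ≡ q'
  label-injective {false , r} {false , r'} _ _ e = cong (false ,_) e
  label-injective {false , r} {true  , r'} (proper r<n) _ e = ⊥-elim (<-irrefl e (<-≤-trans r<n (m≤n+m n r')))
  label-injective {true  , r} {false , r'} _ (proper r'<n) e = ⊥-elim (<-irrefl (sym e) (<-≤-trans r'<n (m≤n+m n r)))
  label-injective {true  , r} {true  , r'} _ _ e = cong (true ,_) (+-cancelʳ-≡ n r r' e)

  <⇒≺ : ∀ {p q} → Proper p → Proper q → label p < label q → T (p ≺ᴾ q)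
  <⇒≺ {false , r} {false , r'} _ _ lt = <⇒<ᵇ lt
  <⇒≺ {false , r} {true  , r'} _ _ lt = tt
  <⇒≺ {true  , r} {false , r'} _ (proper r'<n) lt = <-irrefl refl (<-≤-trans (<-trans lt r'<n) (m≤n+m n r))
  <⇒≺ {true  , r} {true  , r'} _ _ lt = <⇒<ᵇ (+-cancelʳ-< n r r' lt)

  ≺⇒< : ∀ {p q} → Proper p → Proper q → T (p ≺ᴾ q) → label p < label q
  ≺⇒< {false , r} {false , r'} _ _ h = <ᵇ⇒< r r' h
  ≺⇒< {false , r} {true  , r'} (proper r<n) _ _ = <-≤-trans r<n (m≤n+m n r')
  ≺⇒< {true  , r} {true  , r'} _ _ h = +-monoˡ-< n (<ᵇ⇒< r r' h)

  label≡⇒≈ : ∀ {p q} → Proper p → Proper q → label p ≡ label q → T (p ≈ q)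
  label≡⇒≈ pp pq e = T-∧⁺ (T-not (<-irrefl e ∘ ≺⇒< pp pq)) (T-not (<-irrefl (sym e) ∘ ≺⇒< pq pp))

  ≈⇒label≡ : ∀ {p q} → Proper p → Proper q → T (p ≈ q) → label p ≡ label q
  ≈⇒label≡ {p} {q} pp pq h with T-∧⁻ (not (p ≺ᴾ q)) h
  ... | p⊀q , q⊀p = ≤-antisym (≮⇒≥ (T-not⁻ q⊀p ∘ <⇒≺ pq pp)) (≮⇒≥ (T-not⁻ p⊀q ∘ <⇒≺ pp pq))

  Btw⇒between : ∀ {x a b} → Proper x → Proper a → Proper b →
                Btw (label x) (label a) (label b) → T (between x a b)
  Btw⇒between px pa pb (inj₁ (a<x , x<b)) = T-∨⁺ˡ _ (T-∧⁺ (<⇒≺ pa px a<x) (<⇒≺ px pb x<b))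
  Btw⇒between {x} {a} {b} px pa pb (inj₂ (b<x , x<a)) =
    T-∨⁺ʳ (a ≺ᴾ x ∧ x ≺ᴾ b) (T-∧⁺ (<⇒≺ pb px b<x) (<⇒≺ px pa x<a))

  between⇒Btw : ∀ {x a b} → Proper x → Proper a → Proper b →
                T (between x a b) → Btw (label x) (label a) (label b)
  between⇒Btw {x} {a} {b} px pa pb h with T-∨⁻ (a ≺ᴾ x ∧ x ≺ᴾ b) h
  ... | inj₁ h₁ = let a≺x , x≺b = T-∧⁻ (a ≺ᴾ x) h₁ in inj₁ (≺⇒< pa px a≺x , ≺⇒< px pb x≺b)
  ... | inj₂ h₂ = let b≺x , x≺a = T-∧⁻ (b ≺ᴾ x) h₂ in inj₂ (≺⇒< pb px b≺x , ≺⇒< px pa x≺a)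

  Cross⇒crosses : ∀ {a b c d} → Proper a → Proper b → Proper c → Proper d →
                  Cross (label a) (label b) (label c) (label d) → T (crosses a b c d)
  Cross⇒crosses pa pb pc pd (inj₁ (c∈ , d∉)) =
    T-xor⁺ (inj₁ (Btw⇒between pc pa pb c∈ , d∉ ∘ between⇒Btw pd pa pb))
  Cross⇒crosses pa pb pc pd (inj₂ (c∉ , d∈)) =
    T-xor⁺ (inj₂ (c∉ ∘ between⇒Btw pc pa pb , Btw⇒between pd pa pb d∈))

  crosses⇒Cross : ∀ {a b c d} → Proper a → Proper b → Proper c → Proper d →
                  T (crosses a b c d) → Cross (label a) (label b) (label c) (label d)
  crosses⇒Cross {a} {b} {c} pa pb pc pd h with T-xor⁻ (between c a b) h
  ... | inj₁ (c∈ , d∉) = inj₁ (between⇒Btw pc pa pb c∈ , d∉ ∘ Btw⇒between pd pa pb)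
  ... | inj₂ (c∉ , d∈) = inj₂ (c∉ ∘ Btw⇒between pc pa pb , between⇒Btw pd pa pb d∈)

  InBlockˡ : ℕ → ℕ → Set
  InBlockˡ s x = (s ≤ x × x < s + n) ⊎ (x < s × x + 2 * n < s + n)

  2n≡n+n : 2 * n ≡ n + n
  2n≡n+n = cong (n +_) (+-identityʳ n)

  private
    +2n<+n+n⇔< : ∀ x r → x + 2 * n < r + n + n ⇔ x < r
    +2n<+n+n⇔< x r rewrite 2n≡n+n | +-assoc r n n = mk⇔ (+-cancelʳ-< (n + n) x r) (+-monoˡ-< (n + n))

    n+n≤+2n : ∀ x → n + n ≤ x + 2 * n
    n+n≤+2n x = subst (_≤ x + 2 * n) 2n≡n+n (m≤n+m (2 * n) x)

  InBlockˡ⇒inBlock : ∀ {s x} → Proper s → Proper x → InBlockˡ (label s) (label x) → T (inBlock s x)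
  InBlockˡ⇒inBlock {false , r} {x} ps px (inj₁ (r≤x , x<r+n)) =
    T-∧⁺ (T-not λ x≺s → <-irrefl refl (<-≤-trans (≺⇒< px ps x≺s) r≤x))
         (<⇒≺ px (Proper-antipode ps) x<r+n)
  InBlockˡ⇒inBlock {false , r} {x} (proper r<n) px (inj₂ (_ , x+2n<r+n)) =
    ⊥-elim (<-irrefl refl (<-trans x+2n<r+n (<-≤-trans (+-monoˡ-< n r<n) (n+n≤+2n (label x)))))
  InBlockˡ⇒inBlock {true , r} {x} ps px (inj₁ (r+n≤x , _)) =
    T-∨⁺ˡ _ (T-not (λ x≺s → <-irrefl refl (<-≤-trans (≺⇒< px ps x≺s) r+n≤x)))
  InBlockˡ⇒inBlock {true , r} {x} ps px (inj₂ (_ , x+2n<r+n+n)) =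
    T-∨⁺ʳ (not (x ≺ᴾ (true , r)))
          (<⇒≺ px (Proper-antipode ps) (Equivalence.to (+2n<+n+n⇔< (label x) r) x+2n<r+n+n))

  inBlock⇒InBlockˡ : ∀ {s x} → Proper s → Proper x → T (inBlock s x) → InBlockˡ (label s) (label x)
  inBlock⇒InBlockˡ {false , r} {x} (proper r<n) px h with T-∧⁻ (not (x ≺ᴾ (false , r))) h
  ... | x⊀s , x≺s' = inj₁ (≮⇒≥ (T-not⁻ x⊀s ∘ <⇒≺ px (proper r<n)) , ≺⇒< px (proper r<n) x≺s')
  inBlock⇒InBlockˡ {true , r} {x} (proper r<n) px h with T-∨⁻ (not (x ≺ᴾ (true , r))) h
  ... | inj₁ x⊀s =
    inj₁ (≮⇒≥ (T-not⁻ x⊀s ∘ <⇒≺ px (proper r<n)) , <-≤-trans (label<2n px) (+-monoˡ-≤ n (m≤n+m n r)))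
  ... | inj₂ x≺s' = let x<r = ≺⇒< px (proper {false} r<n) x≺s' in
    inj₂ (<-≤-trans x<r (m≤m+n r n) , Equivalence.from (+2n<+n+n⇔< (label x) r) x<r)

module Polygon (n : ℕ) where

  open Labels n public

  record _↝_ (p : Pt n) (q : Pos) : Set where
    constructor encoding
    field
      isProper : Proper q
      encodes  : toℕ p ≡ label q

  open _↝_

  abstract
    pos : Pt n → Pos
    pos p with toℕ p <? n
    ... | yes _ = false , toℕ p
    ... | no  _ = true , toℕ p ∸ n

    encode : ∀ p → p ↝ pos p
    encode p with toℕ p <? n
    ... | yes p<n = encoding (proper p<n) refl
    ... | no  p≮n = encoding (proper p-n<n) (sym (m∸n+n≡m (≮⇒≥ p≮n)))
      where
      p-n<n : toℕ p ∸ n < n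
      p-n<n = +-cancelʳ-< n (toℕ p ∸ n) n
                (subst (_< n + n) (sym (m∸n+n≡m (≮⇒≥ p≮n))) (subst (toℕ p <_) 2n≡n+n (toℕ<n p)))

    point : (q : Pos) → Proper q → Pt n
    point q pq = fromℕ< (subst (label q <_) (sym 2n≡n+n) (label<2n pq))

    point-↝ : ∀ q pq → point q pq ↝ q
    point-↝ q pq = encoding pq (toℕ-fromℕ< _)

  upper : Pt n → Bool
  upper p = proj₁ (pos p)

  offset : Pt n → ℕ
  offset p = proj₂ (pos p)

  ↝-functional : ∀ {p q q'} → p ↝ q → p ↝ q' → q ≡ q'
  ↝-functional e e' = label-injective (isProper e) (isProper e') (trans (sym (encodes e)) (encodes e'))

  ↝-injective : ∀ {p p' q} → p ↝ q → p' ↝ q → p ≡ p'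
  ↝-injective e e' = toℕ-injective (trans (encodes e) (sym (encodes e')))

  ↝⇒≡pos : ∀ {p q} → p ↝ q → pos p ≡ q
  ↝⇒≡pos = ↝-functional (encode _)

  pos-injective : ∀ {p p'} → pos p ≡ pos p' → p ≡ p'
  pos-injective {p} {p'} e = ↝-injective (encode p) (subst (p' ↝_) (sym e) (encode p'))

  pos-point : ∀ q pq → pos (point q pq) ≡ q
  pos-point q pq = ↝⇒≡pos (point-↝ q pq)

  abstract
    anti : Pt n → Pt n
    anti p = point (antipodeᴾ (pos p)) (Proper-antipode (isProper (encode p)))

    anti-↝ : ∀ {p q} → p ↝ q → anti p ↝ antipodeᴾ q
    anti-↝ {p} e rewrite sym (↝⇒≡pos e) = point-↝ (antipodeᴾ (pos p)) (Proper-antipode (isProper (encode p)))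

  pos-anti : ∀ p → pos (anti p) ≡ antipodeᴾ (pos p)
  pos-anti p = ↝⇒≡pos (anti-↝ (encode p))

  anti-involutive : ∀ p → anti (anti p) ≡ p
  anti-involutive p =
    ↝-injective (subst (anti (anti p) ↝_) (antipodeᴾ-involutive (pos p)) (anti-↝ (anti-↝ (encode p)))) (encode p)
    where
    antipodeᴾ-involutive : ∀ q → antipodeᴾ (antipodeᴾ q) ≡ q
    antipodeᴾ-involutive (s , r) = cong (_, r) (not-involutive s)

  anti-≢ : ∀ p → anti p ≢ p
  anti-≢ p e = not-≢ (upper p) (trans (sym (cong proj₁ (pos-anti p))) (cong upper e))
    where
    not-≢ : ∀ b → not b ≢ b
    not-≢ true  ()
    not-≢ false ()

  label+n≡⇒antipode : ∀ {q q'} → Proper q → Proper q' → label q + n ≡ label q' → q' ≡ antipodeᴾ q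
  label+n≡⇒antipode {false , r} pq pq' e = label-injective pq' (Proper-antipode pq) (sym e)
  label+n≡⇒antipode {true  , r} pq pq' e =
    ⊥-elim (<-irrefl refl (<-≤-trans (label<2n pq') (subst (n + n ≤_) e (+-monoˡ-≤ n (m≤n+m n r)))))

  Antipodal⇒≡anti : ∀ {i j} → Antipodal n i j → j ≡ anti i
  Antipodal⇒≡anti {i} {j} (inj₁ e) = ↝-injective (subst (j ↝_) q'≡ (encode j)) (anti-↝ (encode i))
    where
    q'≡ : pos j ≡ antipodeᴾ (pos i)
    q'≡ = label+n≡⇒antipode (isProper (encode i)) (isProper (encode j))
            (trans (cong (_+ n) (sym (encodes (encode i)))) (trans e (encodes (encode j))))
  Antipodal⇒≡anti {i} {j} (inj₂ e) =
    trans (sym (anti-involutive j)) (cong anti (sym (Antipodal⇒≡anti (inj₁ e))))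

  Antipodal-anti : ∀ i → Antipodal n i (anti i)
  Antipodal-anti i = by-half (encode i) (anti-↝ (encode i))
    where
    by-half : ∀ {q} → i ↝ q → anti i ↝ antipodeᴾ q → Antipodal n i (anti i)
    by-half {false , r} e e' = inj₁ (trans (cong (_+ n) (encodes e)) (sym (encodes e')))
    by-half {true  , r} e e' = inj₂ (trans (cong (_+ n) (encodes e')) (sym (encodes e)))

  CentrallySymmetric⇒anti-commute : ∀ M → CentrallySymmetric n M → ∀ p → lookup M (anti p) ≡ anti (lookup M p)
  CentrallySymmetric⇒anti-commute M cs p = Antipodal⇒≡anti (cs p (anti p) (Antipodal-anti p))

  ≡⇒≈ : ∀ {a b qa qb} → a ↝ qa → b ↝ qb → a ≡ b → T (qa ≈ qb)
  ≡⇒≈ ea eb refl = label≡⇒≈ (isProper ea) (isProper eb) (trans (sym (encodes ea)) (encodes eb))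

  ≈⇒≡ : ∀ {a b qa qb} → a ↝ qa → b ↝ qb → T (qa ≈ qb) → a ≡ b
  ≈⇒≡ ea eb h =
    toℕ-injective (trans (encodes ea) (trans (≈⇒label≡ (isProper ea) (isProper eb) h) (sym (encodes eb))))

  ≢⇒≉ : ∀ {a b qa qb} → a ↝ qa → b ↝ qb → a ≢ b → T (not (qa ≈ qb))
  ≢⇒≉ ea eb a≢b = T-not (a≢b ∘ ≈⇒≡ ea eb)

  CrossP⇒crosses : ∀ {a b c d qa qb qc qd} → a ↝ qa → b ↝ qb → c ↝ qc → d ↝ qd →
                   CrossP n a b c d → T (crosses qa qb qc qd)
  CrossP⇒crosses ea eb ec ed x rewrite encodes ea | encodes eb | encodes ec | encodes ed =
    Cross⇒crosses (isProper ea) (isProper eb) (isProper ec) (isProper ed) x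

  crosses⇒CrossP : ∀ {a b c d qa qb qc qd} → a ↝ qa → b ↝ qb → c ↝ qc → d ↝ qd →
                   T (crosses qa qb qc qd) → CrossP n a b c d
  crosses⇒CrossP ea eb ec ed h rewrite encodes ea | encodes eb | encodes ec | encodes ed =
    crosses⇒Cross (isProper ea) (isProper eb) (isProper ec) (isProper ed) h

  ¬CrossP⇒¬crosses : ∀ {a b c d qa qb qc qd} → a ↝ qa → b ↝ qb → c ↝ qc → d ↝ qd →
                     ¬ CrossP n a b c d → T (not (crosses qa qb qc qd))
  ¬CrossP⇒¬crosses ea eb ec ed ¬x = T-not (¬x ∘ crosses⇒CrossP ea eb ec ed)

  InBlock⇒inBlock : ∀ {s x qs qx} → s ↝ qs → x ↝ qx → InBlock n s x → T (inBlock qs qx)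
  InBlock⇒inBlock es ex h rewrite encodes es | encodes ex = InBlockˡ⇒inBlock (isProper es) (isProper ex) h

  inBlock⇒InBlock : ∀ {s x qs qx} → s ↝ qs → x ↝ qx → T (inBlock qs qx) → InBlock n s x
  inBlock⇒InBlock es ex h =
    subst₂ InBlockˡ (sym (encodes es)) (sym (encodes ex)) (inBlock⇒InBlockˡ (isProper es) (isProper ex) h)

  avoids⇒NotIn4 : ∀ {x a b c d qx qa qb qc qd} → x ↝ qx → a ↝ qa → b ↝ qb → c ↝ qc → d ↝ qd →
                  T (avoids qx qa qb qc qd) → NotIn4 n x a b c d
  avoids⇒NotIn4 {qx = qx} {qa} {qb} {qc} {qd} ex ea eb ec ed h
    with T-∧⁻ (not (qx ≈ qa)) h
  ... | x≉a , h₁ with T-∧⁻ (not (qx ≈ qb)) h₁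
  ... | x≉b , h₂ with T-∧⁻ (not (qx ≈ qc)) h₂
  ... | x≉c , x≉d =
    T-not⁻ x≉a ∘ ≡⇒≈ ex ea , T-not⁻ x≉b ∘ ≡⇒≈ ex eb , T-not⁻ x≉c ∘ ≡⇒≈ ex ec , T-not⁻ x≉d ∘ ≡⇒≈ ex ed

  meetsQuad⇒MeetsQuad : ∀ {x y a b c d qx qy qa qb qc qd} → x ↝ qx → y ↝ qy →
                        a ↝ qa → b ↝ qb → c ↝ qc → d ↝ qd →
                        T (meetsQuad qx qy qa qb qc qd) → MeetsQuad n x y a b c d
  meetsQuad⇒MeetsQuad {qx = qx} {qy} {qa} {qb} {qc} {qd} ex ey ea eb ec ed h
    with T-∨⁻ (crosses qx qy qa qb) h
  ... | inj₁ h₁ = inj₁ (crosses⇒CrossP ex ey ea eb h₁)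
  ... | inj₂ h₁ with T-∨⁻ (crosses qx qy qc qd) h₁
  ... | inj₁ h₂ = inj₂ (inj₁ (crosses⇒CrossP ex ey ec ed h₂))
  ... | inj₂ h₂ with T-∨⁻ (crosses qx qy qa qc) h₂
  ... | inj₁ h₃ = inj₂ (inj₂ (inj₁ (crosses⇒CrossP ex ey ea ec h₃)))
  ... | inj₂ h₃ = inj₂ (inj₂ (inj₂ (crosses⇒CrossP ex ey eb ed h₃)))

  Centered⇒¬sameBlock : ∀ {s a b c d qs qa qb qc qd} → s ↝ qs → a ↝ qa → b ↝ qb → c ↝ qc → d ↝ qd →
                        Centered n a b c d → T (not (sameBlock qs qa qb qc qd))
  Centered⇒¬sameBlock {s} {qs = qs} {qa} {qb} {qc} es ea eb ec ed centered = T-not λ h →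
    let sa , h₁ = T-∧⁻ (inBlock qs qa) h
        sb , h₂ = T-∧⁻ (inBlock qs qb) h₁
        sc , sd = T-∧⁻ (inBlock qs qc) h₂
    in centered (s , inBlock⇒InBlock es ea sa , inBlock⇒InBlock es eb sb ,
                     inBlock⇒InBlock es ec sc , inBlock⇒InBlock es ed sd)

  offset<n : ∀ p → offset p < n
  offset<n p with isProper (encode p)
  ... | proper r<n = r<n

  Proper-offset : ∀ s p → Proper (s , offset p)
  Proper-offset s p = proper (offset<n p)

  upper-anti : ∀ p → upper (anti p) ≡ not (upper p)
  upper-anti p = cong proj₁ (pos-anti p)

  offset-anti : ∀ p → offset (anti p) ≡ offset p
  offset-anti p = cong proj₂ (pos-anti p)

  same-offset : ∀ {x y} → offset x ≡ offset y → x ≡ y ⊎ x ≡ anti y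
  same-offset {x} {y} e with upper x Data.Bool.≟ upper y
  ... | yes e' = inj₁ (pos-injective (cong₂ _,_ e' e))
  ... | no  ne = inj₂ (pos-injective (trans (cong₂ _,_ (¬-not ne) (trans e (sym (offset-anti y))))
                                            (cong (_, offset (anti y)) (sym (upper-anti y)))))

-- Chords and parity

indicator : Bool → ℕ
indicator b = if b then 1 else 0

ascents : ∀ {m} → (Fin m → Fin m) → ℕ
ascents f = sum λ i → indicator (toℕ i <ᵇ toℕ (f i))

ascents-involution : ∀ {m} (f : Fin m → Fin m) → (∀ i → f (f i) ≡ i) → (∀ i → f i ≢ i) →
                     ascents f + ascents f ≡ m
ascents-involution {m} f inv fpf = begin
  ascents f + ascents f                 ≡⟨ cong (ascents f +_) ascents≡descents ⟩
  ascents f + sum descent               ≡⟨ ∑-distrib-+ ascent descent ⟨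
  sum (λ i → ascent i + descent i)      ≡⟨ sum-cong-≗ ascent+descent≡1 ⟩
  sum {m} (λ _ → 1)                     ≡⟨ sum-ones m ⟩
  m                                     ∎
  where
  open ≡-Reasoning
  ascent descent : Fin m → ℕ
  ascent  i = indicator (toℕ i <ᵇ toℕ (f i))
  descent i = indicator (toℕ (f i) <ᵇ toℕ i)

  ascents≡descents : ascents f ≡ sum descent
  ascents≡descents = trans (sum-permute ascent (permutation f f inv inv))
                           (sum-cong-≗ λ i → cong (λ j → indicator (toℕ (f i) <ᵇ toℕ j)) (inv i))

  ascent+descent≡1 : ∀ i → ascent i + descent i ≡ 1
  ascent+descent≡1 i with <-cmp (toℕ i) (toℕ (f i))
  ... | tri< i<fi _ _ rewrite <⇒<ᵇ≡true i<fi | ≮⇒<ᵇ≡false (<-asym i<fi) = refl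
  ... | tri≈ _ i≡fi _ = ⊥-elim (fpf i (toℕ-injective (sym i≡fi)))
  ... | tri> _ _ fi<i rewrite <⇒<ᵇ≡true fi<i | ≮⇒<ᵇ≡false (<-asym fi<i) = refl

  sum-ones : ∀ k → sum {k} (λ _ → 1) ≡ k
  sum-ones zero    = refl
  sum-ones (suc k) = cong suc (sum-ones k)

Btw? : ∀ x a b → Dec (Btw x a b)
Btw? x a b = ((a <? x) ×-dec (x <? b)) ⊎-dec ((b <? x) ×-dec (x <? a))

Btw-ordered : ∀ {x a b} → a < b → Btw x a b → a < x × x < b
Btw-ordered a<b (inj₁ a<x<b)       = a<x<b
Btw-ordered a<b (inj₂ (b<x , x<a)) = ⊥-elim (<-asym a<b (<-trans b<x x<a))

Btw-irreflˡ : ∀ {a b} → ¬ Btw a a b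
Btw-irreflˡ (inj₁ (a<a , _)) = <-irrefl refl a<a
Btw-irreflˡ (inj₂ (_ , a<a)) = <-irrefl refl a<a

Btw-irreflʳ : ∀ {a b} → ¬ Btw b a b
Btw-irreflʳ (inj₁ (_ , b<b)) = <-irrefl refl b<b
Btw-irreflʳ (inj₂ (b<b , _)) = <-irrefl refl b<b

module _ {n : ℕ} (N : Vtx n) (pm : IsPerfectMatching n N) (nc : IsNonCrossing n N) where

  chord-interior-closed : ∀ x y → Btw (toℕ y) (toℕ x) (toℕ (lookup N x)) →
                          Btw (toℕ (lookup N y)) (toℕ x) (toℕ (lookup N x))
  chord-interior-closed x y y∈ with Btw? (toℕ (lookup N y)) (toℕ x) (toℕ (lookup N x))
  ... | yes Ny∈ = Ny∈
  ... | no  Ny∉ = ⊥-elim (nc x y y≢x y≢Nx (inj₁ (y∈ , Ny∉)))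
    where
    y≢x : y ≢ x
    y≢x refl = Btw-irreflˡ y∈
    y≢Nx : y ≢ lookup N x
    y≢Nx refl = Btw-irreflʳ y∈

  -- The d points strictly inside a chord are matched among themselves.
  chord-interior-even : ∀ x d → toℕ (lookup N x) ≡ suc (toℕ x + d) → Σ ℕ λ c → c + c ≡ d
  chord-interior-even x d Nx≡ = ascents partner , ascents-involution partner partner-involutive partner-fixedPointFree
    where
    s : ℕ
    s = suc (toℕ x)
    Nx : Pt n
    Nx = lookup N x

    s+i<Nx : ∀ {i} → i < d → s + i < toℕ Nx
    s+i<Nx i<d = subst (_ <_) (sym Nx≡) (+-monoʳ-< s i<d)

    interior : Fin d → Pt n
    interior i = fromℕ< (<-trans (s+i<Nx (toℕ<n i)) (toℕ<n Nx))

    toℕ-interior : ∀ i → toℕ (interior i) ≡ s + toℕ i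
    toℕ-interior i = toℕ-fromℕ< _

    N-interior : ∀ i → toℕ x < toℕ (lookup N (interior i)) × toℕ (lookup N (interior i)) < toℕ Nx
    N-interior i = Btw-ordered x<Nx (chord-interior-closed x (interior i)
      (inj₁ (subst (toℕ x <_) (sym (toℕ-interior i)) (s≤s (m≤m+n (toℕ x) (toℕ i))) ,
             subst (_< toℕ Nx) (sym (toℕ-interior i)) (s+i<Nx (toℕ<n i)))))
      where
      x<Nx : toℕ x < toℕ Nx
      x<Nx = subst (toℕ x <_) (sym Nx≡) (s≤s (m≤m+n (toℕ x) d))

    offset<d : ∀ i → toℕ (lookup N (interior i)) ∸ s < d
    offset<d i = +-cancelˡ-< s _ d
      (subst (_< s + d) (sym (m+[n∸m]≡n (proj₁ (N-interior i))))
             (subst (toℕ (lookup N (interior i)) <_) Nx≡ (proj₂ (N-interior i))))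

    partner : Fin d → Fin d
    partner i = fromℕ< (offset<d i)

    interior-partner : ∀ i → interior (partner i) ≡ lookup N (interior i)
    interior-partner i = toℕ-injective (begin
      toℕ (interior (partner i))            ≡⟨ toℕ-interior (partner i) ⟩
      s + toℕ (partner i)                   ≡⟨ cong (s +_) (toℕ-fromℕ< (offset<d i)) ⟩
      s + (toℕ (lookup N (interior i)) ∸ s) ≡⟨ m+[n∸m]≡n (proj₁ (N-interior i)) ⟩
      toℕ (lookup N (interior i))           ∎)
      where open ≡-Reasoning

    interior-injective : ∀ {i j} → interior i ≡ interior j → i ≡ j
    interior-injective {i} {j} e =
      toℕ-injective (+-cancelˡ-≡ s _ _ (trans (sym (toℕ-interior i)) (trans (cong toℕ e) (toℕ-interior j))))

    partner-involutive : ∀ i → partner (partner i) ≡ i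
    partner-involutive i = interior-injective (begin
      interior (partner (partner i))   ≡⟨ interior-partner (partner i) ⟩
      lookup N (interior (partner i))  ≡⟨ cong (lookup N) (interior-partner i) ⟩
      lookup N (lookup N (interior i)) ≡⟨ proj₂ pm (interior i) ⟩
      interior i                       ∎)
      where open ≡-Reasoning

    partner-fixedPointFree : ∀ i → partner i ≢ i
    partner-fixedPointFree i partner≡i = proj₁ pm (interior i) (trans (sym (interior-partner i)) (cong interior partner≡i))

module _ {m : ℕ} (N : Vtx (suc m)) (pm : IsPerfectMatching (suc m) N) (nc : IsNonCrossing (suc m) N) where

  open Polygon (suc m)

  diameter-parity : ∀ x → toℕ (lookup N x) ≡ toℕ x + suc m → Σ ℕ λ c → c + c ≡ m
  diameter-parity x Nx≡ = chord-interior-even {suc m} N pm nc x m (trans Nx≡ (+-suc (toℕ x) m))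

  no-diameter : (∀ c → c + c ≢ m) → ∀ p → lookup N p ≢ anti p
  no-diameter m-odd p Np≡ap with Antipodal-anti p
  ... | inj₁ e = let c , c+c≡m = diameter-parity p (trans (cong toℕ Np≡ap) (sym e)) in m-odd c c+c≡m
  ... | inj₂ e = let c , c+c≡m = diameter-parity (anti p) (trans (cong toℕ Nap≡p) (sym e)) in m-odd c c+c≡m
    where
    Nap≡p : lookup N (anti p) ≡ p
    Nap≡p = trans (cong (lookup N) (sym Np≡ap)) (proj₂ pm p)

-- Facts decided on order types

module RankTable {m} (t : Comparisons m) where

  open TableOrder t public

  _<ʳ_ : Fin m → Fin m → Bool
  i <ʳ j = lookup (lookup t i) j

  lower : Fin m → SignedIndex m
  lower i = false , i

  _≐_ : Fin m → Fin m → Bool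
  i ≐ j = lower i ≈ lower j

  coversAt : Fin m → Fin m → Fin m → Bool
  coversAt s i j = (i <ʳ s) xor (j <ʳ s)

  coversAfter : Fin m → Fin m → Fin m → Bool
  coversAfter s i j = not (s <ʳ i) xor not (s <ʳ j)

  partners : Fin m → Fin m → Fin m → Fin m → List Bool
  partners i qi j qj =
    (i ≐ j ⇒ qi ≐ qj) ∷ (qi ≐ qj ⇒ i ≐ j) ∷ (i ≐ qj ⇒ qi ≐ j) ∷ (qi ≐ j ⇒ i ≐ qj) ∷ []

  apart : Fin m → Fin m → Fin m → Bool
  apart i j qj = not (i ≐ j) ∧ not (i ≐ qj)

  quotientNoncrossing : Fin m → Fin m → Fin m → Fin m → Bool
  quotientNoncrossing i qi j qj = apart i j qj ⇒ not (crosses (lower i) (lower qi) (lower j) (lower qj))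

  liftsNoncrossing : SignedIndex m → SignedIndex m → SignedIndex m → SignedIndex m → List Bool
  liftsNoncrossing x y u v =
    (apart i j qj ⇒ not (crosses x y u v)) ∷
    (apart i j qj ⇒ not (crosses x y (antipodeᵀ u) (antipodeᵀ v))) ∷
    (apart i j qj ⇒ not (crosses (antipodeᵀ x) (antipodeᵀ y) u v)) ∷
    (apart i j qj ⇒ not (crosses (antipodeᵀ x) (antipodeᵀ y) (antipodeᵀ u) (antipodeᵀ v))) ∷ []
    where
    i j qj : Fin m
    i = proj₂ x
    j = proj₂ u
    qj = proj₂ v

-- Four points lie in an open half circle iff they lie in the one starting at one of them.
centered-flip-fact : OrderTypeFact 4 4
centered-flip-fact σ t = flip-premises ⟹ (C ≈ antipodeᵀ B)
  where
  open RankTable t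
  A B C D A' B' C' D' : SignedIndex 4
  A = lookup σ 0F , 0F
  B = lookup σ 1F , 1F
  C = lookup σ 2F , 2F
  D = lookup σ 3F , 3F
  A' = antipodeᵀ A
  B' = antipodeᵀ B
  C' = antipodeᵀ C
  D' = antipodeᵀ D
  empty : SignedIndex 4 → SignedIndex 4 → Bool
  empty x y = avoids x A B C D ⇒ not (meetsQuad x y A B C D)
  flip-premises : List Bool
  flip-premises =
    not (B ≈ A') ∷ not (D ≈ C') ∷ not (crosses A C B D) ∷
    (C' ≈ A ⇒ D' ≈ B) ∷ (D' ≈ A ⇒ C' ≈ B) ∷ (C' ≈ B ⇒ D' ≈ A) ∷ (D' ≈ B ⇒ C' ≈ A) ∷
    empty B' A' ∷ empty D' C' ∷
    not (sameBlock A A B C D) ∷ not (sameBlock B A B C D) ∷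
    not (sameBlock C A B C D) ∷ not (sameBlock D A B C D) ∷ []

centered-flip-checked : CheckedOnRanks centered-flip-fact
centered-flip-checked = _

quotient-noncrossing-fact : OrderTypeFact 4 4
quotient-noncrossing-fact σ t = liftsNoncrossing X NX Y NY ⟹ quotientNoncrossing 0F 1F 2F 3F
  where
  open RankTable t
  X NX Y NY : SignedIndex 4
  X  = lookup σ 0F , 0F
  NX = lookup σ 1F , 1F
  Y  = lookup σ 2F , 2F
  NY = lookup σ 3F , 3F

quotient-noncrossing-checked : CheckedOnRanks quotient-noncrossing-fact
quotient-noncrossing-checked = _

antipodes-apart-fact : OrderTypeFact 2 2
antipodes-apart-fact σ t = [] ⟹ not (inBlock S X ∧ inBlock S (antipodeᵀ X))
  where
  open RankTable t
  S X : SignedIndex 2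
  S = lookup σ 0F , 0F
  X = lookup σ 1F , 1F

antipodes-apart-checked : CheckedOnRanks antipodes-apart-fact
antipodes-apart-checked = _

cover-jump-fact : OrderTypeFact 0 4
cover-jump-fact _ t = partners 0F 1F 2F 3F ++ quotientNoncrossing 0F 1F 2F 3F ∷ []
                    ⟹ (coversAfter 2F 0F 1F == coversAt 3F 0F 1F)
  where open RankTable t

cover-jump-checked : CheckedOnRanks cover-jump-fact
cover-jump-checked = _

rewired-noncrossing-fact : OrderTypeFact 2 5
rewired-noncrossing-fact σ t =
  partners 0F 1F 2F 3F ++ quotientNoncrossing 0F 1F 2F 3F ∷ not (Y ≈ X) ∷ not (Y ≈ GX) ∷ []
  ⟹ not (crosses X GX Y GY)
  where
  open RankTable t
  X GX Y GY : SignedIndex 5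
  X  = lookup σ 0F , 0F
  GX = lookup σ 0F xor coversAt 4F 0F 1F , 1F
  Y  = lookup σ 1F , 2F
  GY = lookup σ 1F xor coversAt 4F 2F 3F , 3F

rewired-noncrossing-checked : CheckedOnRanks rewired-noncrossing-fact
rewired-noncrossing-checked = _

classification-fact : OrderTypeFact 4 4
classification-fact σ t =
  not (0F ≐ 1F) ∷ (2F <ʳ 3F) ∷ wraps C NC ∷
  partners 0F 1F 2F 3F ++
  (0F ≐ 2F ∨ 0F ≐ 3F ⇒ wraps X NX == wraps C NC) ∷
  (2F <ʳ 0F ∧ 0F <ʳ 1F ⇒ not (wraps X NX)) ∷
  (2F <ʳ 1F ∧ 1F <ʳ 0F ⇒ not (wraps X NX)) ∷
  quotientNoncrossing 0F 1F 2F 3F ∷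
  liftsNoncrossing X NX C NC
  ⟹ (wraps X NX == coversAfter 2F 0F 1F)
  where
  open RankTable t
  X NX C NC : SignedIndex 4
  X  = lookup σ 0F , 0F
  NX = lookup σ 1F , 1F
  C  = lookup σ 2F , 2F
  NC = lookup σ 3F , 3F
  wraps : SignedIndex 4 → SignedIndex 4 → Bool
  wraps (s , _) (s' , _) = s xor s'

classification-checked : CheckedOnRanks classification-fact
classification-checked = _

-- Flips

data QuadPosition (n : ℕ) (p a b c d : Pt n) : Set where
  at-a : p ≡ a → QuadPosition n p a b c d
  at-b : p ≡ b → QuadPosition n p a b c d
  at-c : p ≡ c → QuadPosition n p a b c d
  at-d : p ≡ d → QuadPosition n p a b c d
  outside : NotIn4 n p a b c d → QuadPosition n p a b c d

quad-position : ∀ {n} (p a b c d : Pt n) → QuadPosition n p a b c d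
quad-position p a b c d with p Fin.≟ a | p Fin.≟ b | p Fin.≟ c | p Fin.≟ d
... | yes p≡a | _       | _       | _       = at-a p≡a
... | no  _   | yes p≡b | _       | _       = at-b p≡b
... | no  _   | no  _   | yes p≡c | _       = at-c p≡c
... | no  _   | no  _   | no  _   | yes p≡d = at-d p≡d
... | no  p≢a | no  p≢b | no  p≢c | no  p≢d = outside (p≢a , p≢b , p≢c , p≢d)

CenteredFlip-sym : ∀ {n N N'} → IsPerfectMatching n N' → IsNonCrossing n N' →
                   CenteredFlip n N' N → CenteredFlip n N N'
CenteredFlip-sym {n} {N} {N'} (N'-fpf , N'-inv) N'-nc
                 (a , c , c≢a , c≢b , diagonals , empty , centered , Na≡c , _ , Nb≡d , _ , N≡N') =
  a , b , b≢a , b≢Na , diagonals' , empty' , centered' , refl , N'-inv a , N'Na≡Nb , N'Nb≡Na , N'≡N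
  where
  b d : Pt n
  b = lookup N' a
  d = lookup N' c
  b≢a : b ≢ a
  b≢a = N'-fpf a
  b≢Na : b ≢ lookup N a
  b≢Na b≡Na = c≢b (sym (trans b≡Na Na≡c))
  diagonals' : ¬ CrossP n a b (lookup N a) (lookup N b)
  diagonals' = N'-nc a c c≢a c≢b ∘ subst₂ (CrossP n a b) Na≡c Nb≡d
  avoids-old : ∀ x → NotIn4 n x a (lookup N a) b (lookup N b) → NotIn4 n x a b c d
  avoids-old x (x≢a , x≢Na , x≢b , x≢Nb) =
    x≢a , x≢b , x≢Na ∘ flip trans (sym Na≡c) , x≢Nb ∘ flip trans (sym Nb≡d)
  empty' : ∀ x → NotIn4 n x a (lookup N a) b (lookup N b) → ¬ MeetsQuad n x (lookup N x) a (lookup N a) b (lookup N b)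
  empty' x x-avoids meets = empty x (avoids-old x x-avoids)
    (old-quad (subst (λ y → MeetsQuad n x y a (lookup N a) b (lookup N b)) (N≡N' x (avoids-old x x-avoids)) meets))
    where
    old-quad : ∀ {y} → MeetsQuad n x y a (lookup N a) b (lookup N b) → MeetsQuad n x y a b c d
    old-quad (inj₁ cr)                = inj₂ (inj₂ (inj₁ (subst (CrossP n x _ a) Na≡c cr)))
    old-quad (inj₂ (inj₁ cr))         = inj₂ (inj₂ (inj₂ (subst (CrossP n x _ b) Nb≡d cr)))
    old-quad (inj₂ (inj₂ (inj₁ cr)))  = inj₁ cr
    old-quad (inj₂ (inj₂ (inj₂ cr)))  = inj₂ (inj₁ (subst₂ (CrossP n x _) Na≡c Nb≡d cr))
  centered' : Centered n a (lookup N a) b (lookup N b)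
  centered' (s , sa , sNa , sb , sNb) =
    centered (s , sa , sb , subst (InBlock n s) Na≡c sNa , subst (InBlock n s) Nb≡d sNb)
  N'Na≡Nb : lookup N' (lookup N a) ≡ lookup N b
  N'Na≡Nb = trans (cong (lookup N') Na≡c) (sym Nb≡d)
  N'Nb≡Na : lookup N' (lookup N b) ≡ lookup N a
  N'Nb≡Na = trans (cong (lookup N') Nb≡d) (trans (N'-inv c) (sym Na≡c))
  N'≡N : ∀ x → NotIn4 n x a (lookup N a) b (lookup N b) → lookup N' x ≡ lookup N x
  N'≡N x x-avoids = sym (N≡N' x (avoids-old x x-avoids))

mkCenteredFlip : ∀ {n N N'} a b c d → lookup N a ≡ b → lookup N c ≡ d →
                 c ≢ a → c ≢ b → ¬ CrossP n a c b d →
                 (∀ x → NotIn4 n x a b c d → ¬ MeetsQuad n x (lookup N x) a b c d) → Centered n a b c d →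
                 lookup N' a ≡ c → lookup N' c ≡ a → lookup N' b ≡ d → lookup N' d ≡ b →
                 (∀ x → NotIn4 n x a b c d → lookup N' x ≡ lookup N x) → CenteredFlip n N N'
mkCenteredFlip a _ c _ refl refl c≢a c≢b diagonals empty centered N'a N'c N'b N'd unchanged =
  a , c , c≢a , c≢b , diagonals , empty , centered , N'a , N'c , N'b , N'd , unchanged

HEdge-sym : ∀ {n N N'} → HEdge n N N' → HEdge n N' N
HEdge-sym {N = N} {N'} (N-ncm , N'-ncm , f) =
  N'-ncm , N-ncm , CenteredFlip-sym {N = N'} {N' = N} (proj₁ N-ncm) (proj₂ N-ncm) f

length-filterᵇ-tabulate : ∀ {A : Set} {k} (P : A → Bool) (f : Fin k → A) →
                          length (filterᵇ P (List.tabulate f)) ≡ sum (λ i → indicator (P (f i)))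
length-filterᵇ-tabulate {k = zero}  P f = refl
length-filterᵇ-tabulate {k = suc k} P f with P (f zero)
... | true  = cong suc (length-filterᵇ-tabulate P (f ∘ suc))
... | false = length-filterᵇ-tabulate P (f ∘ suc)

unique-map-filterᵇ : ∀ {A B : Set} (P : A → Bool) (f : A → B) {xs} → Unique xs →
                     (∀ {x y} → T (P x) → T (P y) → f x ≡ f y → x ≡ y) → Unique (List.map f (filterᵇ P xs))
unique-map-filterᵇ P f {[]}     []         inj = []
unique-map-filterᵇ P f {x ∷ xs} (x∉ ∷ xs!) inj with P x in Px
... | false = unique-map-filterᵇ P f xs! inj
... | true  = map⁺ (All.tabulate fx≢) ∷ unique-map-filterᵇ P f xs! inj
  where
  fx≢ : ∀ {y} → y ∈ filterᵇ P xs → f x ≢ f y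
  fx≢ y∈ fx≡fy = let y∈xs , Py = ∈-filter⁻ (T? ∘ P) y∈ in
    All.lookup x∉ y∈xs (inj (subst T (sym Px) _) Py fx≡fy)

below-suc : ∀ {P : ℕ → Set} {k} → (∀ c → c < k → P c) → P k → ∀ c → c < suc k → P c
below-suc below at c c<1+k with m<1+n⇒m<n∨m≡n c<1+k
... | inj₁ c<k  = below c c<k
... | inj₂ refl = at

last-below : ∀ (f : ℕ → Bool) k →
             (Σ ℕ λ c → c < k × T (f c) × (∀ c' → c < c' → c' < k → ¬ T (f c'))) ⊎
             (∀ c → c < k → ¬ T (f c))
last-below f zero = inj₂ λ _ ()
last-below f (suc k) with T? (f k)
... | yes fk =
  inj₁ (k , n<1+n k , fk , λ c' k<c' c'<1+k → ⊥-elim (<-irrefl refl (<-≤-trans k<c' (s≤s⁻¹ c'<1+k))))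
... | no ¬fk with last-below f k
...   | inj₁ (c , c<k , fc , none-after) =
          inj₁ (c , m<n⇒m<1+n c<k , fc , λ c' c<c' c'<1+k →
            below-suc {λ c' → c < c' → ¬ T (f c')} (λ c' c'<k c<c' → none-after c' c<c' c'<k) (λ _ → ¬fk) c' c'<1+k c<c')
...   | inj₂ none = inj₂ (below-suc none ¬fk)

-- Centrally symmetric matchings

module SymmetricMatchings (m : ℕ) (m-odd : ∀ c → c + c ≢ m) where

  n : ℕ
  n = suc m

  open Polygon n public

  Symmetric : Vtx n → Set
  Symmetric N = ∀ p → lookup N (anti p) ≡ anti (lookup N p)

  -- The point of the lower half with offset c; the ⊓ m only makes it total.
  base : ℕ → Pt n
  base c = point (false , c ⊓ m) (proper (s≤s (m⊓n≤n c m)))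

  offset-base : ∀ {c} → c < n → offset (base c) ≡ c
  offset-base {c} c<n = trans (cong proj₂ (pos-point (false , c ⊓ m) _)) (m≤n⇒m⊓n≡m (s≤s⁻¹ c<n))

  module SymmetricNC (N : Vtx n) (N-ncm : IsNCMatching n N) (N-sym : Symmetric N) where

    private
      N-involutive : ∀ p → lookup N (lookup N p) ≡ p
      N-involutive = proj₂ (proj₁ N-ncm)

    partner-offset-anti : ∀ p → offset (lookup N (anti p)) ≡ offset (lookup N p)
    partner-offset-anti p = trans (cong offset (N-sym p)) (offset-anti (lookup N p))

    partner-offset-cong : ∀ {x y} → offset x ≡ offset y → offset (lookup N x) ≡ offset (lookup N y)
    partner-offset-cong {x} {y} e with same-offset e
    ... | inj₁ refl = refl
    ... | inj₂ refl = partner-offset-anti y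

    partner-offset-involutive : ∀ p → offset (lookup N (lookup N p)) ≡ offset p
    partner-offset-involutive p = cong offset (N-involutive p)

    partner-offset-≢ : ∀ p → offset (lookup N p) ≢ offset p
    partner-offset-≢ p e with same-offset e
    ... | inj₁ Np≡p  = proj₁ (proj₁ N-ncm) p Np≡p
    ... | inj₂ Np≡ap = no-diameter N (proj₁ N-ncm) (proj₂ N-ncm) m-odd p Np≡ap

    partner-anti-↝ : ∀ p → lookup N (anti p) ↝ antipodeᴾ (pos (lookup N p))
    partner-anti-↝ p = subst (_↝ antipodeᴾ (pos (lookup N p))) (sym (N-sym p)) (anti-↝ (encode (lookup N p)))

    chordOffsets : Pt n → Pt n → Vec ℕ 4
    chordOffsets p p' = offset p ∷ offset (lookup N p) ∷ offset p' ∷ offset (lookup N p') ∷ []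

    partners-hold : ∀ p p' → All T (RankTable.partners (comparisons (chordOffsets p p')) 0F 1F 2F 3F)
    partners-hold p p' =
      T-⇒ (≡⇒lower≈ ∘ partner-offset-cong ∘ lower≈⇒≡) ∷
      T-⇒ (λ h → ≡⇒lower≈ (trans (sym (partner-offset-involutive p))
                            (trans (partner-offset-cong (lower≈⇒≡ h)) (partner-offset-involutive p')))) ∷
      T-⇒ (λ h → ≡⇒lower≈ (trans (partner-offset-cong (lower≈⇒≡ h)) (partner-offset-involutive p'))) ∷
      T-⇒ (λ h → ≡⇒lower≈ (trans (sym (partner-offset-involutive p)) (partner-offset-cong (lower≈⇒≡ h)))) ∷ []

    chords-noncrossing : ∀ {u v qu qNu qv qNv} → u ↝ qu → lookup N u ↝ qNu → v ↝ qv → lookup N v ↝ qNv →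
                         T (apartᴺ (offset u) (offset v) (offset (lookup N v)) ⇒ not (crosses qu qNu qv qNv))
    chords-noncrossing {u} {v} eu eNu ev eNv = T-⇒ λ apart →
      let u≁v , u≁Nv = apartᴺ⇒≢ (offset u) apart
          v≢u : v ≢ u
          v≢u v≡u = u≁v (cong offset (sym v≡u))
          v≢Nu : v ≢ lookup N u
          v≢Nu v≡Nu = u≁Nv (sym (trans (cong (offset ∘ lookup N) v≡Nu) (partner-offset-involutive u)))
      in ¬CrossP⇒¬crosses eu eNu ev eNv (proj₂ N-ncm u v v≢u v≢Nu)

    lifts-noncrossing : ∀ p p' → All T (RankTable.liftsNoncrossing (comparisons (chordOffsets p p'))
                          (upper p , 0F) (upper (lookup N p) , 1F) (upper p' , 2F) (upper (lookup N p') , 3F))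
    lifts-noncrossing p p' =
      chords-noncrossing ep eNp ep' eNp' ∷
      antiʳ (chords-noncrossing ep eNp (anti-↝ ep') (partner-anti-↝ p')) ∷
      antiˡ (offset p') (offset (lookup N p')) (chords-noncrossing (anti-↝ ep) (partner-anti-↝ p) ep' eNp') ∷
      antiˡ (offset p') (offset (lookup N p'))
        (antiʳ (chords-noncrossing (anti-↝ ep) (partner-anti-↝ p) (anti-↝ ep') (partner-anti-↝ p'))) ∷ []
      where
      ep : p ↝ pos p
      ep = encode p
      eNp : lookup N p ↝ pos (lookup N p)
      eNp = encode (lookup N p)
      ep' : p' ↝ pos p'
      ep' = encode p'
      eNp' : lookup N p' ↝ pos (lookup N p')
      eNp' = encode (lookup N p')
      antiʳ : ∀ {x b} → T (apartᴺ x (offset (anti p')) (offset (lookup N (anti p'))) ⇒ b) →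
                        T (apartᴺ x (offset p') (offset (lookup N p')) ⇒ b)
      antiʳ rewrite offset-anti p' | partner-offset-anti p' = id
      antiˡ : ∀ y z {b} → T (apartᴺ (offset (anti p)) y z ⇒ b) → T (apartᴺ (offset p) y z ⇒ b)
      antiˡ _ _ rewrite offset-anti p = id

    quotient-noncrossing : ∀ p p' → T (RankTable.quotientNoncrossing (comparisons (chordOffsets p p')) 0F 1F 2F 3F)
    quotient-noncrossing p p' = order-type-fact quotient-noncrossing-fact quotient-noncrossing-checked
      (upper p ∷ upper (lookup N p) ∷ upper p' ∷ upper (lookup N p') ∷ []) (chordOffsets p p') (lifts-noncrossing p p')

    partner-≈ : ∀ {x y x' y' qx qy qx' qy'} → x ↝ qx → y ↝ qy → x' ↝ qx' → y' ↝ qy' →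
                lookup N x ≡ y → lookup N x' ≡ y' → T (qx ≈ qx' ⇒ qy ≈ qy')
    partner-≈ ex ey ex' ey' Nx≡y Nx'≡y' = T-⇒ λ x≈x' →
      ≡⇒≈ ey ey' (trans (sym Nx≡y) (trans (cong (lookup N) (≈⇒≡ ex ex' x≈x')) Nx'≡y'))

    centered-flip-symmetric : ∀ {N'} (f : CenteredFlip n N N') → let (a , c , _) = f in c ≡ anti (lookup N a)
    centered-flip-symmetric (a , c , _ , _ , diagonals , empty , centered , _) =
      ≈⇒≡ ec (anti-↝ eb) (order-type-fact centered-flip-fact centered-flip-checked
        (upper a ∷ upper b ∷ upper c ∷ upper d ∷ []) (offset a ∷ offset b ∷ offset c ∷ offset d ∷ [])
        (≢⇒≉ eb (anti-↝ ea) (no-diameter N (proj₁ N-ncm) (proj₂ N-ncm) m-odd a) ∷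
         ≢⇒≉ ed (anti-↝ ec) (no-diameter N (proj₁ N-ncm) (proj₂ N-ncm) m-odd c) ∷
         ¬CrossP⇒¬crosses ea ec eb ed diagonals ∷
         partner-≈ (anti-↝ ec) (anti-↝ ed) ea eb (N-sym c) refl ∷
         partner-≈ (anti-↝ ed) (anti-↝ ec) ea eb N-anti-d refl ∷
         partner-≈ (anti-↝ ec) (anti-↝ ed) eb ea (N-sym c) (N-involutive a) ∷
         partner-≈ (anti-↝ ed) (anti-↝ ec) eb ea N-anti-d (N-involutive a) ∷
         empty-at (anti-↝ eb) (anti-↝ ea) N-anti-b ∷
         empty-at (anti-↝ ed) (anti-↝ ec) N-anti-d ∷
         Centered⇒¬sameBlock ea ea eb ec ed centered ∷ Centered⇒¬sameBlock eb ea eb ec ed centered ∷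
         Centered⇒¬sameBlock ec ea eb ec ed centered ∷ Centered⇒¬sameBlock ed ea eb ec ed centered ∷ []))
      where
      b d : Pt n
      b = lookup N a
      d = lookup N c
      ea : a ↝ pos a
      ea = encode a
      eb : b ↝ pos b
      eb = encode b
      ec : c ↝ pos c
      ec = encode c
      ed : d ↝ pos d
      ed = encode d
      N-anti-b : lookup N (anti b) ≡ anti a
      N-anti-b = trans (N-sym b) (cong anti (N-involutive a))
      N-anti-d : lookup N (anti d) ≡ anti c
      N-anti-d = trans (N-sym d) (cong anti (N-involutive c))
      empty-at : ∀ {x y qx qy} → x ↝ qx → y ↝ qy → lookup N x ≡ y →
                 T (avoids qx (pos a) (pos b) (pos c) (pos d) ⇒ not (meetsQuad qx qy (pos a) (pos b) (pos c) (pos d)))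
      empty-at {x} ex ey Nx≡y = T-⇒ λ x-avoids → T-not λ meets →
        empty x (avoids⇒NotIn4 ex ea eb ec ed x-avoids)
          (subst (λ y → MeetsQuad n x y a b c d) (sym Nx≡y) (meetsQuad⇒MeetsQuad ex ey ea eb ec ed meets))

    flip-preserves : ∀ {N'} → CenteredFlip n N N' →
                     Symmetric N' × (∀ p → offset (lookup N' p) ≡ offset (lookup N p))
    flip-preserves {N'} f@(a , c , _ , _ , _ , _ , _ , N'a≡c , N'c≡a , N'b≡d , N'd≡b , N'≡N) = N'-sym , N'-offset
      where
      b d : Pt n
      b = lookup N a
      d = lookup N c
      N-inv : ∀ p → lookup N (lookup N p) ≡ p
      N-inv = proj₂ (proj₁ N-ncm)
      c≡ab : c ≡ anti b
      c≡ab = centered-flip-symmetric {N'} f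
      d≡aa : d ≡ anti a
      d≡aa = trans (cong (lookup N) c≡ab) (trans (N-sym b) (cong anti (N-inv a)))
      ac≡b : anti c ≡ b
      ac≡b = trans (cong anti c≡ab) (anti-involutive b)
      ad≡a : anti d ≡ a
      ad≡a = trans (cong anti d≡aa) (anti-involutive a)
      anti-avoids : ∀ p → NotIn4 n p a b c d → NotIn4 n (anti p) a b c d
      anti-avoids p (p≢a , p≢b , p≢c , p≢d) =
        (λ e → p≢d (trans (sym (anti-involutive p)) (trans (cong anti e) (sym d≡aa)))) ,
        (λ e → p≢c (trans (sym (anti-involutive p)) (trans (cong anti e) (sym c≡ab)))) ,
        (λ e → p≢b (trans (sym (anti-involutive p)) (trans (cong anti e) ac≡b))) ,
        (λ e → p≢a (trans (sym (anti-involutive p)) (trans (cong anti e) ad≡a)))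
      N'-sym : Symmetric N'
      N'-sym p with quad-position {n} p a b c d
      ... | at-a refl = trans (cong (lookup N') (sym d≡aa)) (trans N'd≡b (trans (sym ac≡b) (cong anti (sym N'a≡c))))
      ... | at-b refl = trans (cong (lookup N') (sym c≡ab)) (trans N'c≡a (trans (sym ad≡a) (cong anti (sym N'b≡d))))
      ... | at-c refl = trans (cong (lookup N') ac≡b) (trans N'b≡d (trans d≡aa (cong anti (sym N'c≡a))))
      ... | at-d refl = trans (cong (lookup N') ad≡a) (trans N'a≡c (trans c≡ab (cong anti (sym N'd≡b))))
      ... | outside p-avoids =
        trans (N'≡N (anti p) (anti-avoids p p-avoids)) (trans (N-sym p) (cong anti (sym (N'≡N p p-avoids))))
      N'-offset : ∀ p → offset (lookup N' p) ≡ offset (lookup N p)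
      N'-offset p with quad-position {n} p a b c d
      ... | at-a refl = trans (cong offset (trans N'a≡c c≡ab)) (offset-anti b)
      ... | at-b refl = trans (cong offset (trans N'b≡d d≡aa)) (trans (offset-anti a) (cong offset (sym (N-inv a))))
      ... | at-c refl = trans (cong offset N'c≡a) (sym (trans (cong offset d≡aa) (offset-anti a)))
      ... | at-d refl = trans (cong offset N'd≡b) (sym (trans (cong offset (trans (N-inv c) c≡ab)) (offset-anti b)))
      ... | outside p-avoids = cong offset (N'≡N p p-avoids)

  module Lifts (M : Vtx n) (M-ncm : IsNCMatching n M) (M-sym : Symmetric M) where

    open SymmetricNC M M-ncm M-sym

    -- lift t is the symmetric lift of the quotient of M whose wrapping chords are those covering
    -- the gap t - 1 | t.
    covers : ℕ → Pt n → Bool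
    covers t p = (offset p <ᵇ t) xor (offset (lookup M p) <ᵇ t)

    liftPos : ℕ → Pt n → Pos
    liftPos t p = upper p xor covers t p , offset (lookup M p)

    lift-at : ℕ → Pt n → Pt n
    lift-at t p = point (liftPos t p) (Proper-offset _ (lookup M p))

    lift-↝ : ∀ t p → lift-at t p ↝ liftPos t p
    lift-↝ t p = point-↝ (liftPos t p) (Proper-offset _ (lookup M p))

    lift : ℕ → Vtx n
    lift t = tabulate (lift-at t)

    lookup-lift : ∀ t p → lookup (lift t) p ≡ lift-at t p
    lookup-lift t = lookup∘tabulate (lift-at t)

    pos-lift : ∀ t p → pos (lift-at t p) ≡ liftPos t p
    pos-lift t p = ↝⇒≡pos (lift-↝ t p)

    offset-lift : ∀ t p → offset (lift-at t p) ≡ offset (lookup M p)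
    offset-lift t p = cong proj₂ (pos-lift t p)

    M-offset-lift : ∀ t p → offset (lookup M (lift-at t p)) ≡ offset p
    M-offset-lift t p = trans (partner-offset-cong (offset-lift t p)) (partner-offset-involutive p)

    covers-lift : ∀ t p → covers t (lift-at t p) ≡ covers t p
    covers-lift t p rewrite offset-lift t p | M-offset-lift t p = xor-comm (offset (lookup M p) <ᵇ t) (offset p <ᵇ t)

    covers-anti : ∀ t p → covers t (anti p) ≡ covers t p
    covers-anti t p rewrite offset-anti p | partner-offset-anti p = refl

    upper-lift : ∀ t p → upper (lift-at t p) ≡ upper p xor covers t p
    upper-lift t p = cong proj₁ (pos-lift t p)

    lift-at-involutive : ∀ t p → lift-at t (lift-at t p) ≡ p
    lift-at-involutive t p = pos-injective (trans (pos-lift t (lift-at t p)) (cong₂ _,_ upper≡ (M-offset-lift t p)))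
      where
      upper≡ : upper (lift-at t p) xor covers t (lift-at t p) ≡ upper p
      upper≡ rewrite upper-lift t p | covers-lift t p
                   | xor-assoc (upper p) (covers t p) (covers t p) | xor-same (covers t p) = xor-identityʳ (upper p)

    lift-at-≢ : ∀ t p → lift-at t p ≢ p
    lift-at-≢ t p e = partner-offset-≢ p (trans (sym (offset-lift t p)) (cong offset e))

    lift-at-anti : ∀ t p → lift-at t (anti p) ≡ anti (lift-at t p)
    lift-at-anti t p =
      ↝-injective (subst (lift-at t (anti p) ↝_) liftPos-anti (lift-↝ t (anti p))) (anti-↝ (lift-↝ t p))
      where
      liftPos-anti : liftPos t (anti p) ≡ antipodeᴾ (liftPos t p)
      liftPos-anti rewrite upper-anti p | covers-anti t p | partner-offset-anti p =
        cong (_, offset (lookup M p)) (sym (not-distribˡ-xor (upper p) (covers t p)))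

    lift-noncrossing : ∀ t → IsNonCrossing n (lift t)
    lift-noncrossing t i j j≢i j≢Gi rewrite lookup-lift t i | lookup-lift t j =
      T-not⁻ (order-type-fact rewired-noncrossing-fact rewired-noncrossing-checked
                (upper i ∷ upper j ∷ []) (offset i ∷ offset (lookup M i) ∷ offset j ∷ offset (lookup M j) ∷ t ∷ [])
                (++⁺ (partners-hold i j) (quotient-noncrossing i j ∷ ≢⇒≉ (encode j) (encode i) j≢i ∷
                                          ≢⇒≉ (encode j) (lift-↝ t i) j≢Gi ∷ [])))
      ∘ CrossP⇒crosses (encode i) (lift-↝ t i) (encode j) (lift-↝ t j)

    lift-ncm : ∀ t → IsNCMatching n (lift t)
    lift-ncm t = ((λ p → subst (_≢ p) (sym (lookup-lift t p)) (lift-at-≢ t p)) ,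
                  (λ p → trans (cong (lookup (lift t)) (lookup-lift t p))
                               (trans (lookup-lift t (lift-at t p)) (lift-at-involutive t p)))) ,
                 lift-noncrossing t

    covers-suc : ∀ t p → offset p ≢ t → offset (lookup M p) ≢ t → covers (suc t) p ≡ covers t p
    covers-suc t p p≢t Mp≢t rewrite <ᵇ-suc p≢t | <ᵇ-suc Mp≢t = refl

    covers-suc-at : ∀ t p → offset p ≡ t → covers (suc t) p ≡ not (covers t p)
    covers-suc-at t p refl
      rewrite <ᵇ-suc (partner-offset-≢ p) | <⇒<ᵇ≡true (n<1+n (offset p))
            | ≮⇒<ᵇ≡false (<-irrefl (refl {x = offset p})) = refl

    covers-partner : ∀ t p → covers t (lookup M p) ≡ covers t p
    covers-partner t p rewrite partner-offset-involutive p = xor-comm (offset (lookup M p) <ᵇ t) (offset p <ᵇ t)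

    covers-suc-at-partner : ∀ t p → offset (lookup M p) ≡ t → covers (suc t) p ≡ not (covers t p)
    covers-suc-at-partner t p Mp≡t = begin
      covers (suc t) p            ≡⟨ covers-partner (suc t) p ⟨
      covers (suc t) (lookup M p) ≡⟨ covers-suc-at t (lookup M p) Mp≡t ⟩
      not (covers t (lookup M p)) ≡⟨ cong not (covers-partner t p) ⟩
      not (covers t p)            ∎
      where open ≡-Reasoning

    -- Moving the gap past the chord at offset t exchanges it with its antipodal image.
    module _ (t : ℕ) (t<n : t < n) where

      private
        a b c d : Pt n
        a = base t
        b = lift-at t a
        c = anti b
        d = anti a

        offset-a : offset a ≡ t
        offset-a = offset-base t<n

        lift-c : lift-at t c ≡ d
        lift-c = trans (lift-at-anti t b) (cong anti (lift-at-involutive t a))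

        lookup-b : lookup (lift t) a ≡ b
        lookup-b = lookup-lift t a

        lookup-d : lookup (lift t) c ≡ d
        lookup-d = trans (lookup-lift t c) lift-c

        lift-suc-a : lift-at (suc t) a ≡ c
        lift-suc-a = ↝-injective (subst (lift-at (suc t) a ↝_) liftPos≡ (lift-↝ (suc t) a)) (anti-↝ (lift-↝ t a))
          where
          liftPos≡ : liftPos (suc t) a ≡ antipodeᴾ (liftPos t a)
          liftPos≡ rewrite covers-suc-at t a offset-a =
            cong (_, offset (lookup M a)) (sym (not-distribʳ-xor (upper a) (covers t a)))

        lift-suc-b : lift-at (suc t) b ≡ d
        lift-suc-b = ↝-injective (subst (lift-at (suc t) b ↝_) liftPos≡ (lift-↝ (suc t) b)) (anti-↝ (encode a))
          where
          upper≡ : upper b xor covers (suc t) b ≡ not (upper a)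
          upper≡ rewrite covers-suc-at-partner t b (trans (M-offset-lift t a) offset-a) | upper-lift t a
                       | covers-lift t a | xor-assoc (upper a) (covers t a) (not (covers t a))
                       | xor-inverseʳ (covers t a) =
            trans (sym (not-distribʳ-xor (upper a) false)) (cong not (xor-identityʳ (upper a)))
          liftPos≡ : liftPos (suc t) b ≡ antipodeᴾ (pos a)
          liftPos≡ = cong₂ _,_ upper≡ (M-offset-lift t a)

        lift-suc-c : lift-at (suc t) c ≡ a
        lift-suc-c = trans (lift-at-anti (suc t) b) (trans (cong anti lift-suc-b) (anti-involutive a))

        lift-suc-d : lift-at (suc t) d ≡ b
        lift-suc-d = trans (lift-at-anti (suc t) a) (trans (cong anti lift-suc-a) (anti-involutive b))

        lift-suc-outside : ∀ x → NotIn4 n x a b c d → lift-at (suc t) x ≡ lift-at t x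
        lift-suc-outside x (x≢a , x≢b , x≢c , x≢d) =
          pos-injective (trans (pos-lift (suc t) x)
            (trans (cong (λ z → upper x xor z , offset (lookup M x)) (covers-suc t x x≁t Mx≁t)) (sym (pos-lift t x))))
          where
          x≁t : offset x ≢ t
          x≁t e with same-offset (trans e (sym offset-a))
          ... | inj₁ x≡a  = x≢a x≡a
          ... | inj₂ x≡aa = x≢d x≡aa
          Mx≁t : offset (lookup M x) ≢ t
          Mx≁t e with same-offset {x} {b} (trans (sym (partner-offset-involutive x))
                                          (trans (partner-offset-cong (trans e (sym offset-a))) (sym (offset-lift t a))))
          ... | inj₁ x≡b  = x≢b x≡b
          ... | inj₂ x≡ab = x≢c x≡ab

      lift-flip : HEdge n (lift t) (lift (suc t))
      lift-flip = lift-ncm t , lift-ncm (suc t) ,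
        mkCenteredFlip {n} {lift t} {lift (suc t)} a b c d lookup-b lookup-d c≢a (anti-≢ b) diagonals empty centered
          (lookup-suc a lift-suc-a) (lookup-suc c lift-suc-c) (lookup-suc b lift-suc-b) (lookup-suc d lift-suc-d)
          (λ x x-avoids → trans (lookup-lift (suc t) x) (trans (lift-suc-outside x x-avoids) (sym (lookup-lift t x))))
        where
        lookup-suc : ∀ x {y} → lift-at (suc t) x ≡ y → lookup (lift (suc t)) x ≡ y
        lookup-suc x = trans (lookup-lift (suc t) x)
        edge : ∀ s x y → lift-at s x ≡ y → lift-at s y ≡ x
        edge s x y refl = lift-at-involutive s x
        noncrossing : ∀ s {x y} → y ≢ x → y ≢ lift-at s x → ¬ CrossP n x (lift-at s x) y (lift-at s y)
        noncrossing s {x} {y} y≢x y≢Gx =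
          subst₂ (λ u v → ¬ CrossP n x u y v) (lookup-lift s x) (lookup-lift s y)
            (lift-noncrossing s x y y≢x (y≢Gx ∘ flip trans (lookup-lift s x)))
        c≢a : c ≢ a
        c≢a e = partner-offset-≢ a (trans (sym (offset-lift t a)) (trans (sym (offset-anti b)) (cong offset e)))
        diagonals : ¬ CrossP n a c b d
        diagonals = subst₂ (λ u v → ¬ CrossP n a u b v) lift-suc-a lift-suc-b
          (noncrossing (suc t) (lift-at-≢ t a) (λ e → anti-≢ b (sym (trans e lift-suc-a))))
        empty : ∀ x → NotIn4 n x a b c d → ¬ MeetsQuad n x (lookup (lift t) x) a b c d
        empty x x-avoids@(x≢a , x≢b , x≢c , x≢d) rewrite lookup-lift t x = λ where
          (inj₁ cr) → noncrossing t (x≢a ∘ sym) (x≢b ∘ sym ∘ edge t x a ∘ sym) cr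
          (inj₂ (inj₁ cr)) → noncrossing t (x≢c ∘ sym) (x≢d ∘ flip trans lift-c ∘ sym ∘ edge t x c ∘ sym)
                                (subst (CrossP n x _ c) (sym lift-c) cr)
          (inj₂ (inj₂ (inj₁ cr))) →
            noncrossing (suc t) (x≢a ∘ sym) (x≢c ∘ flip trans lift-suc-a ∘ sym ∘ edge (suc t) x a ∘ sym)
              (subst₂ (λ u v → CrossP n x u a v) (sym (lift-suc-outside x x-avoids)) (sym lift-suc-a) cr)
          (inj₂ (inj₂ (inj₂ cr))) →
            noncrossing (suc t) (x≢b ∘ sym) (x≢d ∘ flip trans lift-suc-b ∘ sym ∘ edge (suc t) x b ∘ sym)
              (subst₂ (λ u v → CrossP n x u b v) (sym (lift-suc-outside x x-avoids)) (sym lift-suc-b) cr)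
        centered : Centered n a b c d
        centered (s , s-a , _ , _ , s-d) = T-not⁻ (order-type-fact antipodes-apart-fact antipodes-apart-checked
          (upper s ∷ upper a ∷ []) (offset s ∷ offset a ∷ []) [])
          (T-∧⁺ (InBlock⇒inBlock (encode s) (encode a) s-a) (InBlock⇒inBlock (encode s) (anti-↝ (encode a)) s-d))

    lift-connected : ∀ t → t ≤ n → SameComponent n (lift 0) (lift t)
    lift-connected zero    _   = ε
    lift-connected (suc t) t<n = lift-connected t (<⇒≤ t<n) ◅◅ (fwd (lift-flip t t<n) ◅ ε)

    q : ℕ → ℕ
    q x = offset (lookup M (base x))

    lift-jump : ∀ t → t < n → lift (suc t) ≡ lift (q t)
    lift-jump t t<n = tabulate-cong λ p → pos-injective (trans (pos-lift (suc t) p)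
      (trans (cong (λ z → upper p xor z , offset (lookup M p)) (covers≡ p)) (sym (pos-lift (q t) p))))
      where
      tp : Pt n
      tp = base t
      covers≡ : ∀ p → covers (suc t) p ≡ covers (q t) p
      covers≡ p = trans covers-suc-flip (==⇒≡ (order-type-fact cover-jump-fact cover-jump-checked
        [] (chordOffsets p tp) (++⁺ (partners-hold p tp) (quotient-noncrossing p tp ∷ []))))
        where
        covers-suc-flip : covers (suc t) p ≡ not (offset tp <ᵇ offset p) xor not (offset tp <ᵇ offset (lookup M p))
        covers-suc-flip rewrite offset-base t<n | <ᵇ-suc-flip (offset p) t | <ᵇ-suc-flip (offset (lookup M p)) t = refl

  module Classification (M : Vtx n) (M-ncm : IsNCMatching n M) (M-sym : Symmetric M)
                        (N : Vtx n) (N-ncm : IsNCMatching n N) (N-sym : Symmetric N)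
                        (N-offset : ∀ p → offset (lookup N p) ≡ offset (lookup M p)) where

    open Lifts M M-ncm M-sym using (covers; lift; pos-lift)

    open SymmetricNC N N-ncm N-sym

    wraps : Pt n → Bool
    wraps p = upper p xor upper (lookup N p)

    wraps-anti : ∀ p → wraps (anti p) ≡ wraps p
    wraps-anti p rewrite N-sym p | upper-anti p | upper-anti (lookup N p) =
      xor-annihilates-not (upper p) (upper (lookup N p))

    wraps-partner : ∀ p → wraps (lookup N p) ≡ wraps p
    wraps-partner p rewrite proj₂ (proj₁ N-ncm) p = xor-comm (upper (lookup N p)) (upper p)

    wraps-cong : ∀ {p p'} → offset p ≡ offset p' → wraps p ≡ wraps p'
    wraps-cong {p} {p'} e with same-offset e
    ... | inj₁ refl = refl
    ... | inj₂ refl = wraps-anti p'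

    ≡lift : ∀ t → (∀ p → wraps p ≡ covers t p) → N ≡ lift t
    ≡lift t wraps≡covers = trans (sym (tabulate∘lookup N)) (tabulate-cong λ p →
      pos-injective (trans (cong₂ _,_ (upper≡ p) (N-offset p)) (sym (pos-lift t p))))
      where
      upper≡ : ∀ p → upper (lookup N p) ≡ upper p xor covers t p
      upper≡ p = begin
        upper (lookup N p)                           ≡⟨ cong (_xor upper (lookup N p)) (xor-same (upper p)) ⟨
        (upper p xor upper p) xor upper (lookup N p) ≡⟨ xor-assoc (upper p) (upper p) (upper (lookup N p)) ⟩
        upper p xor wraps p                          ≡⟨ cong (upper p xor_) (wraps≡covers p) ⟩
        upper p xor covers t p                       ∎
        where open ≡-Reasoning

    wrappedLeft : ℕ → Bool
    wrappedLeft c = (c <ᵇ offset (lookup N (base c))) ∧ wraps (base c)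

    wrappedLeft-at : ∀ p → offset p < offset (lookup N p) → T (wraps p) → T (wrappedLeft (offset p))
    wrappedLeft-at p p<Np w =
      T-∧⁺ (<⇒<ᵇ (subst (offset p <_) (partner-offset-cong base≡) p<Np)) (subst T (wraps-cong base≡) w)
      where
      base≡ : offset p ≡ offset (base (offset p))
      base≡ = sym (offset-base (offset<n p))

    unwrapped : (∀ c → c < n → ¬ T (wrappedLeft c)) → ∀ p → ¬ T (wraps p)
    unwrapped none p w with <-cmp (offset p) (offset (lookup N p))
    ... | tri< p<Np _ _ = none (offset p) (offset<n p) (wrappedLeft-at p p<Np w)
    ... | tri≈ _ p≡Np _ = partner-offset-≢ p (sym p≡Np)
    ... | tri> _ _ Np<p = none (offset (lookup N p)) (offset<n (lookup N p))
      (wrappedLeft-at (lookup N p) (subst (offset (lookup N p) <_) (sym (partner-offset-involutive p)) Np<p)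
                      (subst T (sym (wraps-partner p)) w))

    wraps≡covers-after : ∀ {c} → c < n → T (wrappedLeft c) →
                         (∀ c' → c < c' → c' < n → ¬ T (wrappedLeft c')) → ∀ p → wraps p ≡ covers (suc c) p
    wraps≡covers-after {c} c<n wl none-after p =
      trans (==⇒≡ (order-type-fact classification-fact classification-checked
                    (upper p ∷ upper (lookup N p) ∷ upper cp ∷ upper (lookup N cp) ∷ []) (chordOffsets p cp)
                    (T-not (partner-offset-≢ p ∘ sym ∘ lower≈⇒≡) ∷
                     subst (λ x → T (x <ᵇ offset (lookup N cp))) (sym offset-cp) cp<Ncp ∷
                     cp-wraps ∷
                     ++⁺ (partners-hold p cp)
                     (T-⇒ (λ h → ≡⇒== (same-chord (T-∨⁻ _ h))) ∷
                      T-⇒ (λ h → T-not (wraps-left-after p (T-∧⁻ _ h))) ∷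
                      T-⇒ (λ h → T-not (wraps-left-after' (T-∧⁻ _ h))) ∷
                      quotient-noncrossing p cp ∷
                      lifts-noncrossing p cp))))
            covers≡
      where
      cp : Pt n
      cp = base c
      offset-cp : offset cp ≡ c
      offset-cp = offset-base c<n
      cp<Ncp : T (c <ᵇ offset (lookup N cp))
      cp<Ncp = proj₁ (T-∧⁻ (c <ᵇ offset (lookup N cp)) wl)
      cp-wraps : T (wraps cp)
      cp-wraps = proj₂ (T-∧⁻ (c <ᵇ offset (lookup N cp)) wl)
      same-chord : T ((false , offset p) ≈ (false , offset cp)) ⊎
                   T ((false , offset p) ≈ (false , offset (lookup N cp))) → wraps p ≡ wraps cp
      same-chord (inj₁ h) = wraps-cong (lower≈⇒≡ h)
      same-chord (inj₂ h) = trans (wraps-cong (lower≈⇒≡ h)) (wraps-partner cp)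
      wraps-left-after : ∀ x → T (offset cp <ᵇ offset x) × T (offset x <ᵇ offset (lookup N x)) → ¬ T (wraps x)
      wraps-left-after x (cp<x , x<Nx) w =
        none-after (offset x) (subst (_< offset x) offset-cp (<ᵇ⇒< _ _ cp<x)) (offset<n x)
                   (wrappedLeft-at x (<ᵇ⇒< _ _ x<Nx) w)
      wraps-left-after' : T (offset cp <ᵇ offset (lookup N p)) × T (offset (lookup N p) <ᵇ offset p) → ¬ T (wraps p)
      wraps-left-after' (cp<Np , Np<p) w = wraps-left-after (lookup N p)
        (cp<Np , subst (λ x → T (offset (lookup N p) <ᵇ x)) (sym (partner-offset-involutive p)) Np<p)
        (subst T (sym (wraps-partner p)) w)
      covers≡ : not (offset cp <ᵇ offset p) xor not (offset cp <ᵇ offset (lookup N p)) ≡ covers (suc c) p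
      covers≡ rewrite offset-cp | N-offset p | <ᵇ-suc-flip (offset p) c | <ᵇ-suc-flip (offset (lookup M p)) c = refl

    classification : Σ ℕ λ t → t ≤ n × N ≡ lift t
    classification with last-below wrappedLeft n
    ... | inj₂ none = 0 , z≤n , ≡lift 0 (λ p → Equivalence.to T-not-≡ (T-not (unwrapped none p)))
    ... | inj₁ (c , c<n , wl , none-after) = suc c , c<n , ≡lift (suc c) (wraps≡covers-after c<n wl none-after)

  module Component (M : Vtx n) (M-ncm : IsNCMatching n M) (M-sym : Symmetric M) where

    open SymmetricNC M M-ncm M-sym
    open Lifts M M-ncm M-sym

    Admissible : Vtx n → Set
    Admissible N = IsNCMatching n N × Symmetric N × (∀ p → offset (lookup N p) ≡ offset (lookup M p))

    flip-admissible : ∀ {N N'} → Admissible N → HEdge n N N' → Admissible N'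
    flip-admissible {N} {N'} (N-ncm , N-sym , N-offset) (_ , N'-ncm , f) =
      let N'-sym , N'-offset = SymmetricNC.flip-preserves N N-ncm N-sym {N'} f
      in N'-ncm , N'-sym , λ p → trans (N'-offset p) (N-offset p)

    component-admissible : ∀ {N} → SameComponent n M N → Admissible N
    component-admissible = go (M-ncm , M-sym , λ _ → refl)
      where
      go : ∀ {N N'} → Admissible N → SameComponent n N N' → Admissible N'
      go adm ε = adm
      go {N} adm (_◅_ {j = N₁} (fwd e) path) = go (flip-admissible {N} {N₁} adm e) path
      go {N} adm (_◅_ {j = N₁} (bwd e) path) = go (flip-admissible {N} {N₁} adm (HEdge-sym {n} {N₁} {N} e)) path

    admissible⇒lift : ∀ {N} → Admissible N → Σ ℕ λ t → t ≤ n × N ≡ lift t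
    admissible⇒lift {N} (N-ncm , N-sym , N-offset) = Classification.classification M M-ncm M-sym N N-ncm N-sym N-offset

    q<n : ∀ x → q x < n
    q<n x = offset<n (lookup M (base x))

    q-involutive : ∀ {x} → x < n → q (q x) ≡ x
    q-involutive {x} x<n = begin
      offset (lookup M (base (q x)))        ≡⟨ partner-offset-cong (offset-base (q<n x)) ⟩
      offset (lookup M (lookup M (base x))) ≡⟨ partner-offset-involutive (base x) ⟩
      offset (base x)                       ≡⟨ offset-base x<n ⟩
      x                                     ∎
      where open ≡-Reasoning

    q-≢ : ∀ {x} → x < n → q x ≢ x
    q-≢ x<n e = partner-offset-≢ (base _) (trans e (sym (offset-base x<n)))

    quotient : Fin n → Fin n
    quotient i = fromℕ< (q<n (toℕ i))

    toℕ-quotient : ∀ i → toℕ (quotient i) ≡ q (toℕ i)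
    toℕ-quotient i = toℕ-fromℕ< (q<n (toℕ i))

    ascents-quotient : ascents quotient + ascents quotient ≡ n
    ascents-quotient = ascents-involution quotient involutive fixedPointFree
      where
      involutive : ∀ i → quotient (quotient i) ≡ i
      involutive i = toℕ-injective
        (trans (toℕ-quotient (quotient i)) (trans (cong q (toℕ-quotient i)) (q-involutive (toℕ<n i))))
      fixedPointFree : ∀ i → quotient i ≢ i
      fixedPointFree i e = q-≢ (toℕ<n i) (trans (sym (toℕ-quotient i)) (cong toℕ e))

    isLeft : Fin n → Bool
    isLeft i = toℕ i <ᵇ q (toℕ i)

    leftEnds : List (Fin n)
    leftEnds = filterᵇ isLeft (allFin n)

    lifts : List (Vtx n)
    lifts = lift 0 List.∷ List.map (lift ∘ suc ∘ toℕ) leftEnds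

    length-lifts : length lifts ≡ suc (ascents quotient)
    length-lifts = cong suc (begin
      length (List.map (lift ∘ suc ∘ toℕ) leftEnds) ≡⟨ length-map (lift ∘ suc ∘ toℕ) leftEnds ⟩
      length leftEnds                               ≡⟨ length-filterᵇ-tabulate isLeft id ⟩
      sum (indicator ∘ isLeft)
        ≡⟨ sum-cong-≗ (λ i → cong (indicator ∘ (toℕ i <ᵇ_)) (sym (toℕ-quotient i))) ⟩
      ascents quotient                              ∎)
      where open ≡-Reasoning

    lift-separates : ∀ {t x} → x < n → x < q x → t ≤ x → lift t ≢ lift (suc x)
    lift-separates {t} {x} x<n x<qx t≤x e = false≢true (begin
      false                                  ≡⟨ covers≡ t (≮⇒<ᵇ≡false (≤⇒≯ t≤x)) (≮⇒<ᵇ≡false (≤⇒≯ (≤-trans t≤x (<⇒≤ x<qx)))) ⟨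
      covers t (base x)                      ≡⟨ upper-lift-base t ⟨
      upper (lookup (lift t) (base x))       ≡⟨ cong (λ N → upper (lookup N (base x))) e ⟩
      upper (lookup (lift (suc x)) (base x)) ≡⟨ upper-lift-base (suc x) ⟩
      covers (suc x) (base x)                ≡⟨ covers≡ (suc x) (<⇒<ᵇ≡true (n<1+n x)) (≮⇒<ᵇ≡false (≤⇒≯ x<qx)) ⟩
      true                                   ∎)
      where
      open ≡-Reasoning
      false≢true : false ≢ true
      false≢true ()
      upper-lift-base : ∀ s → upper (lookup (lift s) (base x)) ≡ covers s (base x)
      upper-lift-base s = trans (cong upper (lookup-lift s (base x)))
        (trans (upper-lift s (base x)) (cong (_xor covers s (base x)) (cong proj₁ (pos-point (false , _) _))))
      covers≡ : ∀ s {a b} → (x <ᵇ s) ≡ a → (q x <ᵇ s) ≡ b → covers s (base x) ≡ a xor b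
      covers≡ s refl refl rewrite offset-base x<n = refl

    lifts-unique : Unique lifts
    lifts-unique =
      map⁺ (All.tabulate λ {i} i∈ → lift-separates (toℕ<n i) (left (proj₂ (∈-filter⁻ (T? ∘ isLeft) i∈))) z≤n) ∷
      unique-map-filterᵇ isLeft (lift ∘ suc ∘ toℕ) (allFin⁺ n) injective
      where
      left : ∀ {i} → T (isLeft i) → toℕ i < q (toℕ i)
      left {i} = <ᵇ⇒< (toℕ i) (q (toℕ i))
      injective : ∀ {i j} → T (isLeft i) → T (isLeft j) → lift (suc (toℕ i)) ≡ lift (suc (toℕ j)) → i ≡ j
      injective {i} {j} li lj e with <-cmp (toℕ i) (toℕ j)
      ... | tri< i<j _ _ = ⊥-elim (lift-separates (toℕ<n j) (left lj) i<j e)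
      ... | tri≈ _ i≡j _ = toℕ-injective i≡j
      ... | tri> _ _ j<i = ⊥-elim (lift-separates (toℕ<n i) (left li) j<i (sym e))

    lift∈lifts : ∀ t → t ≤ n → lift t ∈ lifts
    lift∈lifts = <-rec (λ t → t ≤ n → lift t ∈ lifts) step
      where
      step : ∀ t → (∀ {s} → s < t → s ≤ n → lift s ∈ lifts) → t ≤ n → lift t ∈ lifts
      step zero    _       _   = here refl
      step (suc t) earlier t<n with <-cmp t (q t)
      ... | tri< t<qt _ _ = subst (λ s → lift (suc s) ∈ lifts) (toℕ-fromℕ< t<n)
              (there (∈-map⁺ (lift ∘ suc ∘ toℕ) (∈-filter⁺ (T? ∘ isLeft) (∈-allFin (fromℕ< t<n))
                (subst (λ s → T (s <ᵇ q s)) (sym (toℕ-fromℕ< t<n)) (<⇒<ᵇ t<qt)))))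
      ... | tri≈ _ t≡qt _ = ⊥-elim (q-≢ t<n (sym t≡qt))
      ... | tri> _ _ qt<t = subst (_∈ lifts) (sym (lift-jump t t<n)) (earlier (m<n⇒m<1+n qt<t) (<⇒≤ (q<n t)))

    ∈lifts⇒lift : ∀ {N} → N ∈ lifts → Σ ℕ λ t → t ≤ n × N ≡ lift t
    ∈lifts⇒lift (here refl) = 0 , z≤n , refl
    ∈lifts⇒lift (there N∈) with ∈-map⁻ (lift ∘ suc ∘ toℕ) N∈
    ... | i , _ , refl = suc (toℕ i) , toℕ<n i , refl

    component⇔lifts : ∀ N → SameComponent n M N ⇔ N ∈ lifts
    component⇔lifts N = mk⇔ to from
      where
      to : SameComponent n M N → N ∈ lifts
      to path = let t , t≤n , N≡lift = admissible⇒lift (component-admissible path) in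
        subst (_∈ lifts) (sym N≡lift) (lift∈lifts t t≤n)
      from : N ∈ lifts → SameComponent n M N
      from N∈ = let t , t≤n , N≡lift = ∈lifts⇒lift N∈
                    t₀ , t₀≤n , M≡lift = admissible⇒lift (M-ncm , M-sym , λ _ → refl) in
        subst₂ (SameComponent n) (sym M≡lift) (sym N≡lift)
          (reverse (symmetric (HEdge n)) (lift-connected t₀ t₀≤n) ◅◅ lift-connected t t≤n)

lemma12 : (k : ℕ) → 1 ≤ k → (M : Vtx (2 * k)) →
    IsNCMatching (2 * k) M → CentrallySymmetric (2 * k) M →
    Σ (List (Vtx (2 * k))) λ L →
      length L ≡ k + 1 × Unique L ×
      ((N : Vtx (2 * k)) → SameComponent (2 * k) M N ⇔ N ∈ L)
lemma12 (suc k) (s≤s z≤n) M M-ncm M-cs = lifts , length-lifts≡ , lifts-unique , component⇔lifts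
  where
  -- chosen so that 2 * suc k reduces to suc m
  m : ℕ
  m = k + suc (k + 0)
  m-odd : ∀ c → c + c ≢ m
  m-odd c c+c≡m = even≢odd c k (trans (cong (c +_) (+-identityʳ c)) (trans c+c≡m (+-suc k (k + 0))))
  open SymmetricMatchings m m-odd
  open Component M M-ncm (CentrallySymmetric⇒anti-commute M M-cs)
  length-lifts≡ : length lifts ≡ suc k + 1
  length-lifts≡ = trans length-lifts
    (trans (cong suc (*-cancelˡ-≡ _ _ 2 (trans (cong (a +_) (+-identityʳ a)) ascents-quotient))) (+-comm 1 (suc k)))
    where
    a : ℕ
    a = ascents quotient
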